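{- Let $N>2$, $d:=\lceil\sqrt{\log N}\rceil$, $G:=(\mathbb{Z}/N\mathbb{Z})^\times$, and let $M_*$ be the integer defined below. Let $h\ge1$ and let $\chi_1,\dots,\chi_n$ be distinct characters of the group $G^{M_*}$ such that $\chi_1^h=\chi_2^h=\dots=\chi_n^h$. Then $n\le h^{d/10}$.
   Context: For a finite abelian group $A$ written multiplicatively and $m\ge1$, $A^m:=\{a^m:a\in A\}$. For $h\ge1$ let $K(h):=|G|/|G^h|$. For each prime $p$, let $m_p$ be the largest non-negative integer with $K(p^{m_p})\ge p^{dm_p/10}$, and $M_*:=\prod_p p^{m_p}$. A character of a finite abelian group is a homomorphism to $\mathbb{C}^\times$. -}

module Defs where

open import Data.Nat using (ℕ; zero; suc; _+_; _*_; _^_; _≤_; _<_; _≡ᵇ_; _!; _%_)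
open import Data.Nat.Coprimality using (coprime?)
open import Data.Nat.Primality using (prime?)
open import Data.Bool using (Bool; true; false; if_then_else_; _∧_; T)
open import Data.List using (List; upTo; map; filter)
open import Data.Nat.ListAction using (sum; product)
open import Data.Bool.ListAction using (any)
open import Data.Product using (Σ; _×_)
open import Data.Integer using (+_)
open import Data.Rational using (ℚ; _/_) renaming (_-_ to _-ℚ_; _+_ to _+ℚ_; _*_ to _*ℚ_)
open import Relation.Nullary.Decidable using (⌊_⌋)
open import Relation.Binary.PropositionalEquality using (_≡_)

-- d = ⌈ √(log N) ⌉  (natural logarithm), without reals.
-- a k m = m! * Σ_{j=0}^{m} k^j / j!   (so a k m / m! is the m-th Taylor
-- partial sum of e^k, which increases strictly to e^k).
a : ℕ → ℕ → ℕ
a k zero    = 1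
a k (suc m) = suc m * a k m + k ^ suc m

-- ExpGt k N  :⇔  e^k > N
ExpGt : ℕ → ℕ → Set
ExpGt k N = Σ ℕ (λ m → N * (m !) < a k m)

-- IsCeilSqrtLog N d :⇔ d = ⌈ √(ln N) ⌉, i.e. d is the least natural number
-- with e^(d²) ≥ N.  (For d ≥ 1, e^(d²) is irrational, so ≥ N ⇔ > N; for
-- d = 0 and N ≥ 2 both fail.)
IsCeilSqrtLog : ℕ → ℕ → Set
IsCeilSqrtLog N d = ExpGt (d * d) N × (∀ d′ → d′ < d → ExpGt (d′ * d′) N → Data.Empty.⊥)
  where import Data.Empty

-- G = (ℤ/Nℤ)^× represented by residues 0 ≤ a < N coprime to N.
modN : ℕ → ℕ → ℕ
modN x zero    = x
modN x (suc n) = x % suc n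

isUnit : ℕ → ℕ → Bool
isUnit N x = ⌊ coprime? x N ⌋

isPow : ℕ → ℕ → ℕ → Bool
isPow N M b = any (λ x → isUnit N x ∧ (modN (x ^ M) N ≡ᵇ b)) (upTo N)

InPow : ℕ → ℕ → ℕ → Set
InPow N M b = T (isPow N M b)

count : (ℕ → Bool) → ℕ → ℕ
count p N = sum (map (λ x → if p x then 1 else 0) (upTo N))

cardG : ℕ → ℕ
cardG N = count (isUnit N) N

cardPow : ℕ → ℕ → ℕ
cardPow N h = count (isPow N h) N

-- K(p^m) ≥ p^(d m /10)  ⇔  |G|^10 ≥ p^(d m) * |G^(p^m)|^10
condB : ℕ → ℕ → ℕ → ℕ → Bool
condB N d p m = Data.Nat._≤ᵇ_ (p ^ (d * m) * cardPow N (p ^ m) ^ 10) (cardG N ^ 10)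
  where import Data.Nat

-- largest m ≤ k satisfying f (0 if none)
lastSat : (ℕ → Bool) → ℕ → ℕ
lastSat f zero    = 0
lastSat f (suc k) = if f (suc k) then suc k else lastSat f k

-- m_p : the condition fails for all m > 10 N (when d ≥ 1, p ≥ 2), and holds for m = 0.
mp : ℕ → ℕ → ℕ → ℕ
mp N d p = lastSat (condB N d p) (10 * N)

-- M_* = ∏_p p^{m_p}; primes p > N have m_p = 0 (p ∤ |G|).
Mstar : ℕ → ℕ → ℕ
Mstar N d = product (map (λ p → p ^ mp N d p) (filter prime? (upTo (suc N))))

-- Characters of G^M: homomorphisms into the roots of unity μ_∞ ≅ ℚ/ℤ
-- (x ↦ exp(2πi x)), written additively; values are taken mod ℤ.
ModZ : ℚ → ℚ → Set
ModZ x y = ℚ.denominator-1 (x -ℚ y) ≡ 0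

IsCharacter : ℕ → ℕ → (ℕ → ℚ) → Set
IsCharacter N M χ = ∀ b c → InPow N M b → InPow N M c →
  ModZ (χ (modN (b * c) N)) (χ b +ℚ χ c)

pow : ℕ → (ℕ → ℚ) → (ℕ → ℚ)
pow h χ b = ((+ h) / 1) *ℚ χ b

CharEq : ℕ → ℕ → (ℕ → ℚ) → (ℕ → ℚ) → Set
CharEq N M χ ψ = ∀ b → InPow N M b → ModZ (χ b) (ψ b)

{-# OPTIONS --safe #-}

-- Write A = G^M* and B = A^h = G^(M* h). Since χᵢ(aʰ) = χᵢʰ(a), all χᵢ agree on B, and distinct
-- characters of A agreeing on B number at most [A : B] = |A[h]|: adjoin the elements of A to B one
-- at a time; if g^k is the least positive power of g in the current subgroup C, then
-- [C⟨g⟩ : C] ≥ k, while a character of C⟨g⟩ is determined by its restriction to C and by its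
-- value at g, which that restriction fixes up to a multiple of 1/k (characters take values in ℚ/ℤ).
-- Next, h ↦ |A[h]| is submultiplicative, so it suffices to show |A[p]|¹⁰ ≤ p^d for primes p.
-- If p ≤ N then p^m_p ∣ M*, so |A[p]| ≤ |G^(p^m_p)[p]| = K(p^(m_p + 1)) / K(p^m_p), which is
-- less than p^(d/10) by the maximality of m_p. If p > N, then p is prime to the order of every
-- unit, so A[p] is trivial.

module Submission where

open import Defs
open import Data.Nat using (ℕ; _^_; _≤_; _<_)
open import Data.Fin using (Fin)
open import Data.Rational using (ℚ)
open import Relation.Nullary using (¬_)
open import Relation.Binary.PropositionalEquality using (_≢_)
open import Data.Nat using (NonZero; NonTrivial)


module Arithmetic where

  open import Defs using (lastSat)
  open import Data.Nat
  open import Data.Nat.Properties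
  open import Data.Nat.DivMod using (_%_; _/_; m≡m%n+[m/n]*n)
  open import Data.Nat.Divisibility using (_∣_; divides; ∣1⇒≡1; ∣m+n∣m⇒∣n; ∣m∣n⇒∣m+n; ∣n⇒∣m*n; ∣-trans; n∣m*n)
  open import Data.Nat.Coprimality using (Coprime; coprime-divisor)
  open import Data.Nat.Primality using (Prime)
  open import Data.Nat.Primality.Factorisation using (factorise; PrimeFactorisation)
  open PrimeFactorisation using (factors; isFactorisation; factorsPrime)
  open import Data.Nat.ListAction using (product)
  open import Data.List using ([]; _∷_)
  open import Data.List.Relation.Unary.All using (All; []; _∷_)
  open import Data.Product using (Σ-syntax; _×_; _,_)
  open import Data.Sum using (_⊎_; inj₁; inj₂)
  open import Data.Bool using (Bool; true; false; T)
  open import Data.Unit using (tt)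
  open import Function using (case_of_)
  open import Relation.Nullary using (¬_; contradiction)
  open import Relation.Binary.PropositionalEquality using (_≡_; refl; sym; cong; subst; module ≡-Reasoning)
  open import Algebra.Properties.CommutativeSemigroup *-commutativeSemigroup using (interchange)

  ^-distribʳ-* : ∀ a b e → (a * b) ^ e ≡ a ^ e * b ^ e
  ^-distribʳ-* a b zero    = refl
  ^-distribʳ-* a b (suc e) = begin
    a * b * (a * b) ^ e      ≡⟨ cong (a * b *_) (^-distribʳ-* a b e) ⟩
    a * b * (a ^ e * b ^ e)  ≡⟨ interchange a b (a ^ e) (b ^ e) ⟩
    a * a ^ e * (b * b ^ e)  ∎
    where open ≡-Reasoning

  coprime-1 : ∀ {m} → Coprime 1 m
  coprime-1 (d∣1 , _) = ∣1⇒≡1 d∣1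

  coprime-* : ∀ {a b m} → Coprime a m → Coprime b m → Coprime (a * b) m
  coprime-* {a} {b} {m} a⊥m b⊥m {d} (d∣ab , d∣m) = b⊥m (coprime-divisor d⊥a d∣ab , d∣m)
    where
    d⊥a : Coprime d a
    d⊥a (e∣d , e∣a) = a⊥m (e∣a , ∣-trans e∣d d∣m)

  coprime-^ : ∀ {a m} e → Coprime a m → Coprime (a ^ e) m
  coprime-^ zero    _   = coprime-1
  coprime-^ (suc e) a⊥m = coprime-* a⊥m (coprime-^ e a⊥m)

  coprime-% : ∀ {x m} .{{_ : NonZero m}} → Coprime x m → Coprime (x % m) m
  coprime-% {x} {m} x⊥m {d} (d∣x%m , d∣m) =
    x⊥m (subst (d ∣_) (sym (m≡m%n+[m/n]*n x m)) (∣m∣n⇒∣m+n d∣x%m (∣n⇒∣m*n (x / m) d∣m)) , d∣m)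

  %≡%⇒∣ : ∀ m k n .{{_ : NonZero n}} → m % n ≡ (m + k) % n → n ∣ k
  %≡%⇒∣ m k n eq = ∣m+n∣m⇒∣n (divides ((m + k) / n) (+-cancelˡ-≡ (m % n) _ _ decomposed)) (n∣m*n (m / n))
    where
    open ≡-Reasoning
    decomposed : m % n + (m / n * n + k) ≡ m % n + (m + k) / n * n
    decomposed = begin
      m % n + (m / n * n + k)    ≡⟨ +-assoc (m % n) _ k ⟨
      m % n + m / n * n + k      ≡⟨ cong (_+ k) (m≡m%n+[m/n]*n m n) ⟨
      m + k                      ≡⟨ m≡m%n+[m/n]*n (m + k) n ⟩
      (m + k) % n + (m + k) / n * n ≡⟨ cong (_+ (m + k) / n * n) eq ⟨
      m % n + (m + k) / n * n    ∎

  n<2^n : ∀ n → n < 2 ^ n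
  n<2^n zero    = z<s
  n<2^n (suc n) = begin-strict
    suc n          ≤⟨ n<2^n n ⟩
    2 ^ n          ≡⟨ +-identityʳ (2 ^ n) ⟨
    2 ^ n + 0      <⟨ +-monoʳ-< (2 ^ n) (m^n>0 2 n) ⟩
    2 ^ n + 2 ^ n  ≡⟨ cong (2 ^ n +_) (+-identityʳ (2 ^ n)) ⟨
    2 ^ suc n      ∎
    where open ≤-Reasoning

  ^-ratio-bound : ∀ {A B T P Q} c → A ≡ B * T → P * A ^ c < P * Q * B ^ c → T ^ c < Q
  ^-ratio-bound {A} {B} {T} {P} {Q} c A≡BT PA<PQB = *-cancelˡ-< (B ^ c) (T ^ c) Q (begin-strict
    B ^ c * T ^ c   ≡⟨ ^-distribʳ-* B T c ⟨
    (B * T) ^ c     ≡⟨ cong (_^ c) A≡BT ⟨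
    A ^ c           <⟨ *-cancelˡ-< P (A ^ c) (Q * B ^ c) (subst (P * A ^ c <_) (*-assoc P Q (B ^ c)) PA<PQB) ⟩
    Q * B ^ c       ≡⟨ *-comm Q (B ^ c) ⟩
    B ^ c * Q       ∎)
    where open ≤-Reasoning

  submultiplicative-bound : ∀ (f : ℕ → ℕ) c d → f 1 ≤ 1 → (∀ a b → f (a * b) ≤ f a * f b) →
    (∀ p → Prime p → f p ^ c ≤ p ^ d) → ∀ h → .{{_ : NonZero h}} → f h ^ c ≤ h ^ d
  submultiplicative-bound f c d f1≤1 f-* f-prime h = subst (λ h → f h ^ c ≤ h ^ d) (sym (isFactorisation fact))
    (over-primes (factors fact) (factorsPrime fact))
    where
    fact : PrimeFactorisation h
    fact = factorise h
    over-primes : ∀ ps → All Prime ps → f (product ps) ^ c ≤ product ps ^ d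
    over-primes []       []           = begin
      f 1 ^ c    ≤⟨ ^-monoˡ-≤ c f1≤1 ⟩
      1 ^ c      ≡⟨ ^-zeroˡ c ⟩
      1          ≡⟨ ^-zeroˡ d ⟨
      1 ^ d      ∎
      where open ≤-Reasoning
    over-primes (p ∷ ps) (p-prime ∷ ps-prime) = begin
      f (p * product ps) ^ c                ≤⟨ ^-monoˡ-≤ c (f-* p (product ps)) ⟩
      (f p * f (product ps)) ^ c            ≡⟨ ^-distribʳ-* (f p) (f (product ps)) c ⟩
      f p ^ c * f (product ps) ^ c          ≤⟨ *-mono-≤ (f-prime p p-prime) (over-primes ps ps-prime) ⟩
      p ^ d * product ps ^ d                ≡⟨ ^-distribʳ-* p (product ps) d ⟨
      (p * product ps) ^ d                  ∎
      where open ≤-Reasoning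

  LeastPositive : (ℕ → Bool) → ℕ → Set
  LeastPositive f k = 1 ≤ k × T (f k) × (∀ i → 1 ≤ i → i < k → ¬ T (f i))

  least-positive : ∀ (f : ℕ → Bool) {K} → 1 ≤ K → T (f K) → Σ[ k ∈ ℕ ] LeastPositive f k
  least-positive f {K} 1≤K fK with search K
    where
    search : ∀ K → (Σ[ k ∈ ℕ ] LeastPositive f k) ⊎ (∀ i → 1 ≤ i → i ≤ K → ¬ T (f i))
    search zero = inj₂ (λ i 1≤i i≤0 _ → contradiction (≤-trans 1≤i i≤0) λ ())
    search (suc K) with search K
    ... | inj₁ least = inj₁ least
    ... | inj₂ none with f (suc K) in eq
    ...   | true  = inj₁ (suc K , s≤s z≤n , subst T (sym eq) tt , λ i 1≤i i<1+K → none i 1≤i (≤-pred i<1+K))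
    ...   | false = inj₂ λ i 1≤i i≤1+K fi → case m≤n⇒m<n∨m≡n i≤1+K of λ where
        (inj₁ i<1+K) → none i 1≤i (≤-pred i<1+K) fi
        (inj₂ refl)  → subst T eq fi
  ... | inj₁ least = least
  ... | inj₂ none  = contradiction fK (none K 1≤K ≤-refl)

  lastSat-sat : ∀ f K → lastSat f K ≡ 0 ⊎ T (f (lastSat f K))
  lastSat-sat f zero    = inj₁ refl
  lastSat-sat f (suc K) with f (suc K) in eq
  ... | true  = inj₂ (subst T (sym eq) tt)
  ... | false = lastSat-sat f K

  lastSat-max : ∀ f K j → lastSat f K < j → j ≤ K → f j ≡ false
  lastSat-max f zero    j lt j≤0 = contradiction j≤0 (<⇒≱ lt)
  lastSat-max f (suc K) j lt j≤1+K with f (suc K) in eq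
  ... | true  = contradiction j≤1+K (<⇒≱ lt)
  ... | false with m≤n⇒m<n∨m≡n j≤1+K
  ...   | inj₁ j<1+K = lastSat-max f K j lt (≤-pred j<1+K)
  ...   | inj₂ refl  = eq


module Counting where

  open import Defs using (count)
  open import Data.Nat
  open import Data.Nat.Properties
  open import Data.Nat.DivMod using (_%_; m<n⇒m%n≡m; [m+n]%n≡m%n)
  open import Data.Nat.ListAction.Properties using (sum-++)
  open import Data.Bool using (Bool; true; false; T; _∧_; not; if_then_else_)
  open import Data.Bool.Properties using (∧-assoc; T-∧)
  open import Algebra.Properties.CommutativeSemigroup +-commutativeSemigroup using (interchange)
  open import Data.List using (upTo; map; [_]; _++_; _∷ʳ_)
  open import Data.Nat.ListAction using (sum)
  open import Data.List.Properties using (upTo-∷ʳ; map-++)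
  open import Data.Product using (_×_; _,_; proj₁; proj₂)
  open import Data.Sum using (inj₁; inj₂)
  open import Data.Unit using (tt)
  open import Function using (_∘_; _⇔_; Equivalence; mk⇔)
  open import Relation.Nullary using (¬_; contradiction)
  open import Relation.Binary.PropositionalEquality using (_≡_; refl; sym; trans; cong; cong₂; subst; module ≡-Reasoning)

  ind : Bool → ℕ
  ind b = if b then 1 else 0

  ind-true : ∀ {b} → T b → ind b ≡ 1
  ind-true {true} _ = refl

  ¬T⇒T-not : ∀ {b} → ¬ T b → T (not b)
  ¬T⇒T-not {false} _  = tt
  ¬T⇒T-not {true}  ¬t = ¬t tt

  ind-false : ∀ {b} → ¬ T b → ind b ≡ 0
  ind-false {false} _  = refl
  ind-false {true}  ¬t = contradiction tt ¬t

  count-suc : ∀ p n → count p (suc n) ≡ count p n + ind (p n)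
  count-suc p n = begin
    sum (map f (upTo (suc n)))        ≡⟨ cong (sum ∘ map f) (sym (upTo-∷ʳ n)) ⟩
    sum (map f (upTo n ∷ʳ n))         ≡⟨ cong sum (map-++ f (upTo n) [ n ]) ⟩
    sum (map f (upTo n) ++ [ f n ])   ≡⟨ sum-++ (map f (upTo n)) [ f n ] ⟩
    count p n + (f n + 0)             ≡⟨ cong (count p n +_) (+-identityʳ (f n)) ⟩
    count p n + f n                   ∎
    where
    open ≡-Reasoning
    f : ℕ → ℕ
    f = ind ∘ p

  count-cong : ∀ {p q} n → (∀ x → x < n → p x ≡ q x) → count p n ≡ count q n
  count-cong zero    eq = refl
  count-cong {p} {q} (suc n) eq = begin
    count p (suc n)      ≡⟨ count-suc p n ⟩
    count p n + ind (p n) ≡⟨ cong₂ _+_ (count-cong n (λ x x<n → eq x (m<n⇒m<1+n x<n))) (cong ind (eq n ≤-refl)) ⟩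
    count q n + ind (q n) ≡⟨ count-suc q n ⟨
    count q (suc n)      ∎
    where open ≡-Reasoning

  ind-mono : ∀ {a b} → (T a → T b) → ind a ≤ ind b
  ind-mono {false}         _   = z≤n
  ind-mono {true}  {true}  _   = ≤-refl
  ind-mono {true}  {false} a⇒b = contradiction tt a⇒b

  count-mono : ∀ {p q} n → (∀ x → x < n → T (p x) → T (q x)) → count p n ≤ count q n
  count-mono zero    _   = z≤n
  count-mono {p} {q} (suc n) p⇒q = begin
    count p (suc n)       ≡⟨ count-suc p n ⟩
    count p n + ind (p n) ≤⟨ +-mono-≤ (count-mono n (λ x x<n → p⇒q x (m<n⇒m<1+n x<n))) (ind-mono (p⇒q n ≤-refl)) ⟩
    count q n + ind (q n) ≡⟨ count-suc q n ⟨
    count q (suc n)       ∎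
    where open ≤-Reasoning

  count-cong-⇔ : ∀ {p q} n → (∀ x → x < n → T (p x) ⇔ T (q x)) → count p n ≡ count q n
  count-cong-⇔ n p⇔q = ≤-antisym (count-mono n (λ x x<n → Equivalence.to (p⇔q x x<n)))
                                  (count-mono n (λ x x<n → Equivalence.from (p⇔q x x<n)))

  ind≤1 : ∀ b → ind b ≤ 1
  ind≤1 true  = ≤-refl
  ind≤1 false = z≤n

  count≤n : ∀ p n → count p n ≤ n
  count≤n p zero    = z≤n
  count≤n p (suc n) = begin
    count p (suc n)       ≡⟨ count-suc p n ⟩
    count p n + ind (p n) ≤⟨ +-mono-≤ (count≤n p n) (ind≤1 (p n)) ⟩
    n + 1                 ≡⟨ +-comm n 1 ⟩
    suc n                 ∎
    where open ≤-Reasoning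

  count≡0 : ∀ p n → (∀ x → x < n → ¬ T (p x)) → count p n ≡ 0
  count≡0 p zero    _   = refl
  count≡0 p (suc n) ¬px = begin
    count p (suc n)       ≡⟨ count-suc p n ⟩
    count p n + ind (p n) ≡⟨ cong₂ _+_ (count≡0 p n (λ x x<n → ¬px x (m<n⇒m<1+n x<n))) (ind-false (¬px n ≤-refl)) ⟩
    0                     ∎
    where open ≡-Reasoning

  count>0 : ∀ p n x → x < n → T (p x) → 0 < count p n
  count>0 p (suc n) x x<1+n px rewrite count-suc p n with m<1+n⇒m<n∨m≡n x<1+n
  ... | inj₁ x<n  = <-≤-trans (count>0 p n x x<n px) (m≤m+n _ _)
  ... | inj₂ refl = <-≤-trans (subst (0 <_) (sym (ind-true px)) z<s) (m≤n+m _ _)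

  count≡1 : ∀ p n c → c < n → T (p c) → (∀ x → x < n → T (p x) → x ≡ c) → count p n ≡ 1
  count≡1 p (suc n) c c<1+n pc unique with m<1+n⇒m<n∨m≡n c<1+n
  ... | inj₁ c<n = begin
    count p (suc n)       ≡⟨ count-suc p n ⟩
    count p n + ind (p n) ≡⟨ cong₂ _+_ (count≡1 p n c c<n pc (λ x x<n → unique x (m<n⇒m<1+n x<n)))
                                      (ind-false (λ pn → <-irrefl (sym (unique n ≤-refl pn)) c<n)) ⟩
    1                     ∎
    where open ≡-Reasoning
  ... | inj₂ refl = begin
    count p (suc c)       ≡⟨ count-suc p c ⟩
    count p c + ind (p c) ≡⟨ cong₂ _+_ (count≡0 p c (λ x x<c px → <-irrefl (unique x (m<n⇒m<1+n x<c) px) x<c))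
                                      (ind-true pc) ⟩
    1                     ∎
    where open ≡-Reasoning

  count-split : ∀ (p q : ℕ → Bool) n → count p n ≡ count (λ x → p x ∧ q x) n + count (λ x → p x ∧ not (q x)) n
  count-split p q zero    = refl
  count-split p q (suc n) = begin
    count p (suc n)                     ≡⟨ count-suc p n ⟩
    count p n + ind (p n)               ≡⟨ cong₂ _+_ (count-split p q n) (ind-split (p n) (q n)) ⟩
    (count p∧q n + count p∧¬q n) + (ind (p∧q n) + ind (p∧¬q n))
                                        ≡⟨ interchange (count p∧q n) _ _ _ ⟩
    (count p∧q n + ind (p∧q n)) + (count p∧¬q n + ind (p∧¬q n))
                                        ≡⟨ cong₂ _+_ (count-suc p∧q n) (count-suc p∧¬q n) ⟨
    count p∧q (suc n) + count p∧¬q (suc n) ∎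
    where
    open ≡-Reasoning
    p∧q p∧¬q : ℕ → Bool
    p∧q  x = p x ∧ q x
    p∧¬q x = p x ∧ not (q x)
    ind-split : ∀ a b → ind a ≡ ind (a ∧ b) + ind (a ∧ not b)
    ind-split false _     = refl
    ind-split true  true  = refl
    ind-split true  false = refl

  count-injection : ∀ {p q} a b (f : ℕ → ℕ) →
    (∀ x → x < a → T (p x) → f x < b × T (q (f x))) →
    (∀ x y → x < a → y < a → T (p x) → T (p y) → f x ≡ f y → x ≡ y) →
    count p a ≤ count q b
  count-injection zero b f maps inj = z≤n
  count-injection {p} {q} (suc a) b f maps inj with p a in pa≡
  ... | false = begin
    count p (suc a)       ≡⟨ count-suc p a ⟩
    count p a + ind (p a) ≡⟨ cong (λ b → count p a + ind b) pa≡ ⟩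
    count p a + 0         ≡⟨ +-identityʳ _ ⟩
    count p a             ≤⟨ count-injection a b f (λ x x<a → maps x (m<n⇒m<1+n x<a))
                               (λ x y x<a y<a → inj x y (m<n⇒m<1+n x<a) (m<n⇒m<1+n y<a)) ⟩
    count q b             ∎
    where open ≤-Reasoning
  ... | true = begin
    count p (suc a)                 ≡⟨ count-suc p a ⟩
    count p a + ind (p a)           ≡⟨ cong (λ b → count p a + ind b) pa≡ ⟩
    count p a + 1                   ≤⟨ +-monoˡ-≤ 1 rest ⟩
    count q-fa b + 1                ≡⟨ cong (count q-fa b +_) (sym single) ⟩
    count q-fa b + count q=fa b     ≡⟨ +-comm (count q-fa b) _ ⟩
    count q=fa b + count q-fa b     ≡⟨ count-split q (λ x → x ≡ᵇ f a) b ⟨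
    count q b                       ∎
    where
    open ≤-Reasoning
    pa : T (p a)
    pa = subst T (sym pa≡) tt
    q=fa q-fa : ℕ → Bool
    q=fa x = q x ∧ (x ≡ᵇ f a)
    q-fa x = q x ∧ not (x ≡ᵇ f a)
    single : count q=fa b ≡ 1
    single = count≡1 q=fa b (f a) (proj₁ (maps a ≤-refl pa))
               (Equivalence.from T-∧ (proj₂ (maps a ≤-refl pa) , ≡⇒≡ᵇ (f a) (f a) refl))
               (λ x _ qx → ≡ᵇ⇒≡ x (f a) (proj₂ (Equivalence.to T-∧ qx)))
    fx≢fa : ∀ x → x < a → T (p x) → ¬ T (f x ≡ᵇ f a)
    fx≢fa x x<a px e = <-irrefl (inj x a (m<n⇒m<1+n x<a) ≤-refl px pa (≡ᵇ⇒≡ (f x) (f a) e)) x<a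
    rest : count p a ≤ count q-fa b
    rest = count-injection a b f
      (λ x x<a px → let (fx<b , qfx) = maps x (m<n⇒m<1+n x<a) px in
         fx<b , Equivalence.from T-∧ (qfx , ¬T⇒T-not (fx≢fa x x<a px)))
      (λ x y x<a y<a → inj x y (m<n⇒m<1+n x<a) (m<n⇒m<1+n y<a))

  private
    <ᵇ-suc-∧-<ᵇ : ∀ m b → (m <ᵇ suc b) ∧ (m <ᵇ b) ≡ (m <ᵇ b)
    <ᵇ-suc-∧-<ᵇ zero    zero    = refl
    <ᵇ-suc-∧-<ᵇ zero    (suc b) = refl
    <ᵇ-suc-∧-<ᵇ (suc m) zero    = refl
    <ᵇ-suc-∧-<ᵇ (suc m) (suc b) = <ᵇ-suc-∧-<ᵇ m b

    <ᵇ-suc-∧-≮ᵇ : ∀ m b → (m <ᵇ suc b) ∧ not (m <ᵇ b) ≡ (m ≡ᵇ b)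
    <ᵇ-suc-∧-≮ᵇ zero    zero    = refl
    <ᵇ-suc-∧-≮ᵇ zero    (suc b) = refl
    <ᵇ-suc-∧-≮ᵇ (suc m) zero    = refl
    <ᵇ-suc-∧-≮ᵇ (suc m) (suc b) = <ᵇ-suc-∧-≮ᵇ m b

  count-fibres : ∀ (p q : ℕ → Bool) (φ : ℕ → ℕ) a b c →
    (∀ x → x < a → T (p x) → φ x < b) →
    (∀ z → z < b → count (λ x → p x ∧ (φ x ≡ᵇ z)) a ≡ ind (q z) * c) →
    count p a ≡ count q b * c
  count-fibres p q φ a b c φ<b fibre = trans
    (count-cong-⇔ a (λ x x<a →
      mk⇔ (λ px → Equivalence.from T-∧ (px , <⇒<ᵇ (φ<b x x<a px))) (proj₁ ∘ Equivalence.to T-∧)))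
    (below b fibre)
    where
    below : ∀ b → (∀ z → z < b → count (λ x → p x ∧ (φ x ≡ᵇ z)) a ≡ ind (q z) * c) →
            count (λ x → p x ∧ (φ x <ᵇ b)) a ≡ count q b * c
    below zero    _     = count≡0 _ a (λ x _ → proj₂ ∘ Equivalence.to T-∧)
    below (suc b) fibre = begin
      count (λ x → p x ∧ (φ x <ᵇ suc b)) a
        ≡⟨ count-split (λ x → p x ∧ (φ x <ᵇ suc b)) (λ x → φ x <ᵇ b) a ⟩
      count (λ x → (p x ∧ (φ x <ᵇ suc b)) ∧ (φ x <ᵇ b)) a + count (λ x → (p x ∧ (φ x <ᵇ suc b)) ∧ not (φ x <ᵇ b)) a
        ≡⟨ cong₂ _+_ (count-cong a (λ x _ → trans (∧-assoc (p x) _ _) (cong (p x ∧_) (<ᵇ-suc-∧-<ᵇ (φ x) b))))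
                     (count-cong a (λ x _ → trans (∧-assoc (p x) _ _) (cong (p x ∧_) (<ᵇ-suc-∧-≮ᵇ (φ x) b)))) ⟩
      count (λ x → p x ∧ (φ x <ᵇ b)) a + count (λ x → p x ∧ (φ x ≡ᵇ b)) a
        ≡⟨ cong₂ _+_ (below b (λ z z<b → fibre z (m<n⇒m<1+n z<b))) (fibre b ≤-refl) ⟩
      count q b * c + ind (q b) * c
        ≡⟨ *-distribʳ-+ c (count q b) (ind (q b)) ⟨
      (count q b + ind (q b)) * c
        ≡⟨ cong (_* c) (count-suc q b) ⟨
      count q (suc b) * c ∎
      where open ≡-Reasoning

  count-+ : ∀ p a b → count p (a + b) ≡ count p a + count (λ x → p (a + x)) b
  count-+ p a zero    = trans (cong (count p) (+-identityʳ a)) (sym (+-identityʳ _))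
  count-+ p a (suc b) = begin
    count p (a + suc b)                                        ≡⟨ cong (count p) (+-suc a b) ⟩
    count p (suc (a + b))                                      ≡⟨ count-suc p (a + b) ⟩
    count p (a + b) + ind (p (a + b))                          ≡⟨ cong (_+ ind (p (a + b))) (count-+ p a b) ⟩
    count p a + count (λ x → p (a + x)) b + ind (p (a + b))    ≡⟨ +-assoc (count p a) _ _ ⟩
    count p a + (count (λ x → p (a + x)) b + ind (p (a + b)))  ≡⟨ cong (count p a +_) (count-suc (λ x → p (a + x)) b) ⟨
    count p a + count (λ x → p (a + x)) (suc b)                ∎
    where open ≡-Reasoning

  count-mod : ∀ p N .{{_ : NonZero N}} k → count (λ m → p (m % N)) (k * N) ≡ k * count p N
  count-mod p N zero    = refl
  count-mod p N (suc k) = begin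
    count (λ m → p (m % N)) (N + k * N)                                  ≡⟨ count-+ _ N (k * N) ⟩
    count (λ m → p (m % N)) N + count (λ m → p ((N + m) % N)) (k * N)
      ≡⟨ cong₂ _+_ (count-cong N (λ m m<N → cong p (m<n⇒m%n≡m m<N)))
                   (count-cong (k * N) (λ m _ → cong p (trans (cong (_% N) (+-comm N m)) ([m+n]%n≡m%n m N)))) ⟩
    count p N + count (λ m → p (m % N)) (k * N)                          ≡⟨ cong (count p N +_) (count-mod p N k) ⟩
    count p N + k * count p N                                            ∎
    where open ≡-Reasoning


module Residues (N : ℕ) .{{_ : NonTrivial N}} where

  open import Data.Nat
  open import Data.Nat.Properties
  open import Data.Nat.DivMod using (_%_; m%n<n; m<n⇒m%n≡m; m%n%n≡m%n; %-distribˡ-*)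
  open import Data.Nat.Divisibility using (_∣_; n∣m⇒m%n≡0)
  open import Data.Nat.Coprimality using (Coprime; coprime-divisor; coprime-Bézout)
  import Data.Nat.Coprimality as Coprimality
  open import Data.Nat.GCD using (module Bézout)
  open import Data.Fin using (toℕ; fromℕ<)
  open import Data.Fin.Properties using (pigeonhole; toℕ-fromℕ<; toℕ<n)
  open import Data.Product using (Σ-syntax; _×_; _,_)
  open import Data.Sum using (inj₁; inj₂)
  open import Relation.Binary.PropositionalEquality using (_≡_; refl; sym; trans; cong; cong₂; module ≡-Reasoning)
  open Arithmetic

  instance
    N-nonZero : NonZero N
    N-nonZero = nonTrivial⇒nonZero N

  1<N : 1 < N
  1<N = nonTrivial⇒n>1 N

  infixl 7 _*%_
  infixr 8 _^%_

  _*%_ : ℕ → ℕ → ℕ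
  x *% y = (x * y) % N

  _^%_ : ℕ → ℕ → ℕ
  x ^% e = (x ^ e) % N

  1%N : 1 % N ≡ 1
  1%N = m<n⇒m%n≡m 1<N

  %-*%ˡ : ∀ x y → (x % N) *% y ≡ x *% y
  %-*%ˡ x y = begin
    (x % N * y) % N               ≡⟨ %-distribˡ-* (x % N) y N ⟩
    (x % N % N * (y % N)) % N     ≡⟨ cong (λ t → (t * (y % N)) % N) (m%n%n≡m%n x N) ⟩
    (x % N * (y % N)) % N         ≡⟨ %-distribˡ-* x y N ⟨
    (x * y) % N                   ∎
    where open ≡-Reasoning

  *%-comm : ∀ x y → x *% y ≡ y *% x
  *%-comm x y = cong (_% N) (*-comm x y)

  %-*%ʳ : ∀ x y → x *% (y % N) ≡ x *% y
  %-*%ʳ x y = trans (*%-comm x (y % N)) (trans (%-*%ˡ y x) (*%-comm y x))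

  *%-assoc : ∀ x y z → x *% y *% z ≡ x *% (y *% z)
  *%-assoc x y z = trans (%-*%ˡ (x * y) z) (trans (cong (_% N) (*-assoc x y z)) (sym (%-*%ʳ x (y * z))))

  *%-identityˡ : ∀ x → 1 *% x ≡ x % N
  *%-identityˡ x = cong (_% N) (*-identityˡ x)

  *%-identityʳ : ∀ x → x *% 1 ≡ x % N
  *%-identityʳ x = cong (_% N) (*-identityʳ x)

  *%<N : ∀ x y → x *% y < N
  *%<N x y = m%n<n (x * y) N

  ^%<N : ∀ x e → x ^% e < N
  ^%<N x e = m%n<n (x ^ e) N

  ^%-%  : ∀ x e → x ^% e % N ≡ x ^% e
  ^%-% x e = m%n%n≡m%n (x ^ e) N

  ^%-zero : ∀ x → x ^% 0 ≡ 1
  ^%-zero x = 1%N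

  ^%-one : ∀ x → x ^% 1 ≡ x % N
  ^%-one x = cong (_% N) (*-identityʳ x)

  ^%-+ : ∀ x a b → x ^% (a + b) ≡ x ^% a *% x ^% b
  ^%-+ x a b = trans (cong (_% N) (^-distribˡ-+-* x a b)) (%-distribˡ-* (x ^ a) (x ^ b) N)

  ^%-suc : ∀ x → x < N → ∀ i → x ^% suc i ≡ x ^% i *% x
  ^%-suc x x<N i = begin
    x ^% suc i          ≡⟨ cong (x ^%_) (+-comm 1 i) ⟩
    x ^% (i + 1)        ≡⟨ ^%-+ x i 1 ⟩
    x ^% i *% x ^% 1    ≡⟨ cong (x ^% i *%_) (trans (^%-one x) (m<n⇒m%n≡m x<N)) ⟩
    x ^% i *% x         ∎
    where open ≡-Reasoning

  %-^% : ∀ x e → (x % N) ^% e ≡ x ^% e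
  %-^% x zero    = refl
  %-^% x (suc e) = begin
    (x % N * (x % N) ^ e) % N         ≡⟨ %-*%ʳ (x % N) ((x % N) ^ e) ⟨
    (x % N) *% ((x % N) ^% e)         ≡⟨ cong ((x % N) *%_) (%-^% x e) ⟩
    (x % N) *% (x ^% e)               ≡⟨ %-*%ʳ (x % N) (x ^ e) ⟩
    (x % N) *% (x ^ e)                ≡⟨ %-*%ˡ x (x ^ e) ⟩
    (x * x ^ e) % N                   ∎
    where open ≡-Reasoning

  ^%-^% : ∀ x a b → (x ^% a) ^% b ≡ x ^% (a * b)
  ^%-^% x a b = trans (%-^% (x ^ a) b) (cong (_% N) (^-*-assoc x a b))

  *%-^% : ∀ x y e → (x *% y) ^% e ≡ x ^% e *% y ^% e
  *%-^% x y e = trans (%-^% (x * y) e) (trans (cong (_% N) (^-distribʳ-* x y e)) (%-distribˡ-* (x ^ e) (y ^ e) N))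

  1^% : ∀ e → 1 ^% e ≡ 1
  1^% e = trans (cong (_% N) (^-zeroˡ e)) 1%N

  private
    *%-cancelˡ-≤ : ∀ {u} y z → Coprime u N → y ≤ z → z < N → u *% y ≡ u *% z → y ≡ z
    *%-cancelˡ-≤ {u} y z u⊥N y≤z z<N eq = ≤-antisym y≤z (m∸n≡0⇒m≤n z∸y≡0)
      where
      N∣u[z∸y] : N ∣ u * (z ∸ y)
      N∣u[z∸y] = %≡%⇒∣ (u * y) (u * (z ∸ y)) N
        (trans eq (cong (_% N) (trans (cong (u *_) (sym (m+[n∸m]≡n y≤z))) (*-distribˡ-+ u y (z ∸ y)))))
      z∸y≡0 : z ∸ y ≡ 0
      z∸y≡0 = trans (sym (m<n⇒m%n≡m (≤-<-trans (m∸n≤m z y) z<N)))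
                    (n∣m⇒m%n≡0 (z ∸ y) N (coprime-divisor (Coprimality.sym u⊥N) N∣u[z∸y]))

  *%-cancelˡ : ∀ {u} y z → Coprime u N → y < N → z < N → u *% y ≡ u *% z → y ≡ z
  *%-cancelˡ y z u⊥N y<N z<N eq with ≤-total y z
  ... | inj₁ y≤z = *%-cancelˡ-≤ y z u⊥N y≤z z<N eq
  ... | inj₂ z≤y = sym (*%-cancelˡ-≤ z y u⊥N z≤y y<N (sym eq))

  coprime-*% : ∀ {x y} → Coprime x N → Coprime y N → Coprime (x *% y) N
  coprime-*% x⊥N y⊥N = coprime-% (coprime-* x⊥N y⊥N)

  coprime-^% : ∀ {x} e → Coprime x N → Coprime (x ^% e) N
  coprime-^% e x⊥N = coprime-% (coprime-^ e x⊥N)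

  order : ∀ {x} → Coprime x N → Σ[ o ∈ ℕ ] 1 ≤ o × o ≤ N × x ^% o ≡ 1
  order {x} x⊥N with pigeonhole (n<1+n N) (λ i → fromℕ< (^%<N x (toℕ i)))
  ... | i , j , i<j , same = o , m<n⇒0<n∸m i<j , ≤-trans (m∸n≤m (toℕ j) (toℕ i)) (≤-pred (toℕ<n j)) , sym x^o≡1
    where
    open ≡-Reasoning
    o : ℕ
    o = toℕ j ∸ toℕ i
    x^i≡x^j : x ^% toℕ i ≡ x ^% toℕ j
    x^i≡x^j = trans (sym (toℕ-fromℕ< (^%<N x (toℕ i)))) (trans (cong toℕ same) (toℕ-fromℕ< (^%<N x (toℕ j))))
    shifted : x ^% toℕ i *% 1 ≡ x ^% toℕ i *% x ^% o
    shifted = begin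
      x ^% toℕ i *% 1            ≡⟨ trans (*%-identityʳ _) (^%-% x (toℕ i)) ⟩
      x ^% toℕ i                 ≡⟨ x^i≡x^j ⟩
      x ^% toℕ j                 ≡⟨ cong (x ^%_) (m+[n∸m]≡n (<⇒≤ i<j)) ⟨
      x ^% (toℕ i + o)           ≡⟨ ^%-+ x (toℕ i) o ⟩
      x ^% toℕ i *% x ^% o       ∎
    x^o≡1 : 1 ≡ x ^% o
    x^o≡1 = *%-cancelˡ 1 (x ^% o) (coprime-^% (toℕ i) x⊥N) 1<N (^%<N x o) shifted

  ^%-pred-inverse : ∀ x → x < N → ∀ {o} → 1 ≤ o → x ^% o ≡ 1 → x ^% (o ∸ 1) *% x ≡ 1
  ^%-pred-inverse x x<N {o} 1≤o x^o≡1 = begin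
    x ^% (o ∸ 1) *% x       ≡⟨ ^%-suc x x<N (o ∸ 1) ⟨
    x ^% (1 + (o ∸ 1))      ≡⟨ cong (x ^%_) (m+[n∸m]≡n 1≤o) ⟩
    x ^% o                  ≡⟨ x^o≡1 ⟩
    1                       ∎
    where open ≡-Reasoning

  private
    ^%≡1-Bézout : ∀ x {c e} s t → x ^% c ≡ 1 → x ^% e ≡ 1 → 1 + s * c ≡ t * e → x % N ≡ 1
    ^%≡1-Bézout x {c} {e} s t x^c≡1 x^e≡1 bez = begin
      x % N                      ≡⟨ m%n%n≡m%n x N ⟨
      x % N % N                  ≡⟨ *%-identityʳ (x % N) ⟨
      x % N *% 1                 ≡⟨ cong₂ _*%_ (^%-one x) (trans (cong (_^% s) x^c≡1) (1^% s)) ⟨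
      x ^% 1 *% (x ^% c) ^% s    ≡⟨ cong (x ^% 1 *%_) (trans (^%-^% x c s) (cong (x ^%_) (*-comm c s))) ⟩
      x ^% 1 *% x ^% (s * c)     ≡⟨ ^%-+ x 1 (s * c) ⟨
      x ^% (1 + s * c)           ≡⟨ cong (x ^%_) (trans bez (*-comm t e)) ⟩
      x ^% (e * t)               ≡⟨ ^%-^% x e t ⟨
      (x ^% e) ^% t              ≡⟨ cong (_^% t) x^e≡1 ⟩
      1 ^% t                     ≡⟨ 1^% t ⟩
      1                          ∎
      where open ≡-Reasoning

  ^%≡1-coprime : ∀ x {a b} → x ^% a ≡ 1 → x ^% b ≡ 1 → Coprime a b → x % N ≡ 1
  ^%≡1-coprime x x^a≡1 x^b≡1 a⊥b with coprime-Bézout a⊥b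
  ... | Bézout.+- s t eq = ^%≡1-Bézout x t s x^b≡1 x^a≡1 eq
  ... | Bézout.-+ s t eq = ^%≡1-Bézout x s t x^a≡1 x^b≡1 eq

  *%-interchange : ∀ a b c d → (a *% b) *% (c *% d) ≡ (a *% c) *% (b *% d)
  *%-interchange a b c d = begin
    (a *% b) *% (c *% d)      ≡⟨ trans (%-*%ˡ (a * b) (c *% d)) (%-*%ʳ (a * b) (c * d)) ⟩
    (a * b * (c * d)) % N     ≡⟨ cong (_% N) (interchange a b c d) ⟩
    (a * c * (b * d)) % N     ≡⟨ trans (%-*%ˡ (a * c) (b *% d)) (%-*%ʳ (a * c) (b * d)) ⟨
    (a *% c) *% (b *% d)      ∎
    where
    open ≡-Reasoning
    open import Algebra.Properties.CommutativeSemigroup *-commutativeSemigroup using (interchange)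


module PowerSubgroups (N : ℕ) .{{_ : NonTrivial N}} where

  open import Defs using (isUnit; isPow; modN; count; cardG; cardPow)
  open import Data.Nat
  open import Data.Nat.Properties
  open import Data.Nat.DivMod using (_%_; m<n⇒m%n≡m)
  open import Data.Nat.Divisibility using (_∣_; divides)
  open import Data.Nat.Coprimality using (Coprime; coprime?)
  open import Data.Bool using (Bool; T; _∧_)
  open import Data.Bool.Properties using (T-∧)
  open import Data.List.Membership.Propositional.Properties using (∈-upTo⁺; ∈-upTo⁻)
  open import Data.List.Relation.Unary.Any using (Any)
  open import Data.List.Relation.Unary.Any.Properties using (any⁺; any⁻)
  open import Data.List.Membership.Propositional using (find; lose)
  open import Data.Product using (Σ-syntax; _×_; _,_)
  open import Function using (_⇔_; mk⇔; Equivalence)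
  open import Relation.Nullary using (Dec; yes; no)
  open import Relation.Nullary.Decidable using (T?; toWitness; fromWitness)
  open import Relation.Binary.PropositionalEquality using (_≡_; refl; sym; trans; cong; cong₂; subst; module ≡-Reasoning)
  open Arithmetic
  open Residues N
  open Counting

  modN≡% : ∀ x → modN x N ≡ x % N
  modN≡% x = lemma x N
    where
    lemma : ∀ x n .{{_ : NonZero n}} → modN x n ≡ x % n
    lemma x (suc n) = refl

  record IsPower (e b : ℕ) : Set where
    constructor power
    field
      base      : ℕ
      base<N    : base < N
      base-unit : Coprime base N
      base^e    : base ^% e ≡ b

  isPow⇔IsPower : ∀ e b → T (isPow N e b) ⇔ IsPower e b
  isPow⇔IsPower e b = mk⇔ sound complete
    where
    witness : ℕ → Bool
    witness x = isUnit N x ∧ (modN (x ^ e) N ≡ᵇ b)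
    sound : T (isPow N e b) → IsPower e b
    sound t with find (any⁻ witness _ t)
    ... | x , x∈ , wx = let (ux , eqx) = Equivalence.to T-∧ wx in
      power x (∈-upTo⁻ x∈) (toWitness {a? = coprime? x N} ux) (trans (sym (modN≡% (x ^ e))) (≡ᵇ⇒≡ _ b eqx))
    complete : IsPower e b → T (isPow N e b)
    complete (power x x<N x⊥N x^e≡b) = any⁺ witness (lose (∈-upTo⁺ x<N)
      (Equivalence.from T-∧ (fromWitness {a? = coprime? x N} x⊥N , ≡⇒≡ᵇ _ b (trans (modN≡% (x ^ e)) x^e≡b))))

  IsPower-<N : ∀ {e b} → IsPower e b → b < N
  IsPower-<N {e} (power x _ _ x^e≡b) = subst (_< N) x^e≡b (^%<N x e)

  IsPower-unit : ∀ {e b} → IsPower e b → Coprime b N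
  IsPower-unit {e} (power x _ x⊥N x^e≡b) = subst (λ t → Coprime t N) x^e≡b (coprime-^% e x⊥N)

  IsPower-1 : ∀ e → IsPower e 1
  IsPower-1 e = power 1 1<N coprime-1 (1^% e)

  IsPower-*% : ∀ {e b c} → IsPower e b → IsPower e c → IsPower e (b *% c)
  IsPower-*% {e} (power x x<N x⊥N x^e≡b) (power y y<N y⊥N y^e≡c) =
    power (x *% y) (*%<N x y) (coprime-*% x⊥N y⊥N) (trans (*%-^% x y e) (cong₂ _*%_ x^e≡b y^e≡c))

  IsPower-^% : ∀ {e b} i → IsPower e b → IsPower e (b ^% i)
  IsPower-^% {e} {b} i (power x x<N x⊥N x^e≡b) = power (x ^% i) (^%<N x i) (coprime-^% i x⊥N) (begin
    (x ^% i) ^% e   ≡⟨ ^%-^% x i e ⟩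
    x ^% (i * e)    ≡⟨ cong (x ^%_) (*-comm i e) ⟩
    x ^% (e * i)    ≡⟨ ^%-^% x e i ⟨
    (x ^% e) ^% i   ≡⟨ cong (_^% i) x^e≡b ⟩
    b ^% i          ∎)
    where open ≡-Reasoning

  IsPower-∣ : ∀ {e e' b} → e ∣ e' → IsPower e' b → IsPower e b
  IsPower-∣ {e} (divides q refl) (power x x<N x⊥N x^e'≡b) =
    power (x ^% q) (^%<N x q) (coprime-^% q x⊥N) (trans (^%-^% x q e) x^e'≡b)

  ^%-IsPower : ∀ {e b} f → IsPower e b → IsPower (e * f) (b ^% f)
  ^%-IsPower {e} f (power x x<N x⊥N x^e≡b) = power x x<N x⊥N (trans (sym (^%-^% x e f)) (cong (_^% f) x^e≡b))

  IsPower-root : ∀ {e z} f → IsPower (e * f) z → Σ[ c ∈ ℕ ] IsPower e c × c ^% f ≡ z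
  IsPower-root {e} f (power x x<N x⊥N x^ef≡z) = x ^% e , power x x<N x⊥N refl , trans (^%-^% x e f) x^ef≡z

  IsPower-inverse : ∀ {e c} → IsPower e c → Σ[ c⁻¹ ∈ ℕ ] IsPower e c⁻¹ × c⁻¹ *% c ≡ 1
  IsPower-inverse {e} {c} c∈ with order (IsPower-unit c∈)
  ... | o , 1≤o , _ , c^o≡1 = c ^% (o ∸ 1) , IsPower-^% (o ∸ 1) c∈ , ^%-pred-inverse c (IsPower-<N c∈) 1≤o c^o≡1

  isPow-sound : ∀ e {b} → T (isPow N e b) → IsPower e b
  isPow-sound e {b} = Equivalence.to (isPow⇔IsPower e b)

  isPow-complete : ∀ {e b} → IsPower e b → T (isPow N e b)
  isPow-complete {e} {b} = Equivalence.from (isPow⇔IsPower e b)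

  cardG≡cardPow-1 : cardG N ≡ cardPow N 1
  cardG≡cardPow-1 = count-cong-⇔ N (λ x x<N → mk⇔
    (λ unit → isPow-complete {1} (power x x<N (toWitness {a? = coprime? x N} unit) (trans (^%-one x) (m<n⇒m%n≡m x<N))))
    (λ x∈G → fromWitness {a? = coprime? x N} (IsPower-unit (isPow-sound 1 x∈G))))

  cardPow>0 : ∀ e → 0 < cardPow N e
  cardPow>0 e = count>0 (isPow N e) N 1 1<N (isPow-complete (IsPower-1 e))

  fibre : ℕ → ℕ → ℕ → ℕ → Bool
  fibre e f a x = isPow N e x ∧ (x ^% f ≡ᵇ a)

  torsion : ℕ → ℕ → ℕ
  torsion e f = count (fibre e f 1) N

  fibre-sound : ∀ {e f a x} → T (fibre e f a x) → IsPower e x × x ^% f ≡ a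
  fibre-sound {e} {f} {a} {x} t = let (x∈ , eq) = Equivalence.to T-∧ t in isPow-sound e x∈ , ≡ᵇ⇒≡ (x ^% f) a eq

  fibre-complete : ∀ {e f a x} → IsPower e x → x ^% f ≡ a → T (fibre e f a x)
  fibre-complete {e} {f} {a} {x} x∈ eq = Equivalence.from T-∧ (isPow-complete x∈ , ≡⇒≡ᵇ (x ^% f) a eq)

  fibre-translate : ∀ e f {u} a → IsPower e u → count (fibre e f a) N ≤ count (fibre e f (u ^% f *% a)) N
  fibre-translate e f {u} a u∈ = count-injection N N (u *%_)
    (λ x _ t → let (x∈ , x^f≡a) = fibre-sound {e} {f} t in
       *%<N u x , fibre-complete {e} {f} (IsPower-*% u∈ x∈) (trans (*%-^% u x f) (cong (u ^% f *%_) x^f≡a)))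
    (λ x y x<N y<N _ _ → *%-cancelˡ x y (IsPower-unit {e} u∈) x<N y<N)

  fibre-over-power : ∀ e f {c} → IsPower e c → count (fibre e f (c ^% f)) N ≡ torsion e f
  fibre-over-power e f {c} c∈ = using-inverse (IsPower-inverse {e} c∈)
    where
    open ≡-Reasoning
    using-inverse : Σ[ c⁻¹ ∈ ℕ ] IsPower e c⁻¹ × c⁻¹ *% c ≡ 1 → count (fibre e f (c ^% f)) N ≡ torsion e f
    using-inverse (c⁻¹ , c⁻¹∈ , c⁻¹c≡1) = ≤-antisym
      (subst (λ a → count (fibre e f (c ^% f)) N ≤ count (fibre e f a) N) (begin
        c⁻¹ ^% f *% c ^% f     ≡⟨ *%-^% c⁻¹ c f ⟨
        (c⁻¹ *% c) ^% f        ≡⟨ cong (_^% f) c⁻¹c≡1 ⟩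
        1 ^% f                 ≡⟨ 1^% f ⟩
        1                      ∎) (fibre-translate e f (c ^% f) c⁻¹∈))
      (subst (λ a → torsion e f ≤ count (fibre e f a) N)
        (trans (*%-identityʳ (c ^% f)) (^%-% c f)) (fibre-translate e f 1 c∈))

  fibre-size : ∀ e f z → count (fibre e f z) N ≡ ind (isPow N (e * f) z) * torsion e f
  fibre-size e f z = by-membership (T? (isPow N (e * f) z))
    where
    by-membership : Dec (T (isPow N (e * f) z)) → count (fibre e f z) N ≡ ind (isPow N (e * f) z) * torsion e f
    by-membership (no z∉) = trans
      (count≡0 (fibre e f z) N (λ x _ t → let (x∈ , x^f≡z) = fibre-sound {e} {f} t in
         z∉ (isPow-complete (subst (IsPower (e * f)) x^f≡z (^%-IsPower f x∈)))))
      (sym (cong (_* torsion e f) (ind-false z∉)))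
    by-membership (yes z∈) = let (c , c∈ , c^f≡z) = IsPower-root {e} f (isPow-sound (e * f) z∈) in
      trans (subst (λ a → count (fibre e f a) N ≡ torsion e f) c^f≡z (fibre-over-power e f c∈))
            (trans (sym (*-identityˡ (torsion e f))) (cong (_* torsion e f) (sym (ind-true z∈))))

  cardPow-torsion : ∀ e f → cardPow N e ≡ cardPow N (e * f) * torsion e f
  cardPow-torsion e f = count-fibres (isPow N e) (isPow N (e * f)) (_^% f) N N (torsion e f)
    (λ x _ _ → ^%<N x f) (λ z _ → fibre-size e f z)

  torsion-∣ : ∀ {e e'} f → e ∣ e' → torsion e' f ≤ torsion e f
  torsion-∣ {e} {e'} f e∣e' = count-mono N (λ x _ t → let (x∈ , x^f≡1) = fibre-sound {e'} {f} t in
    fibre-complete {e} {f} (IsPower-∣ e∣e' x∈) x^f≡1)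

  torsion-* : ∀ e a b → torsion e (a * b) ≤ torsion e a * torsion e b
  torsion-* e a b = begin
    torsion e (a * b)                   ≡⟨ *-cancelˡ-≡ _ _ (cardPow N (e * a * b)) both-sides ⟩
    torsion (e * a) b * torsion e a     ≤⟨ *-monoˡ-≤ (torsion e a) (torsion-∣ b (divides a (*-comm e a))) ⟩
    torsion e b * torsion e a           ≡⟨ *-comm (torsion e b) (torsion e a) ⟩
    torsion e a * torsion e b           ∎
    where
    open ≤-Reasoning
    instance
      |G^eab|-nonZero : NonZero (cardPow N (e * a * b))
      |G^eab|-nonZero = >-nonZero (cardPow>0 (e * a * b))
    both-sides : cardPow N (e * a * b) * torsion e (a * b) ≡ cardPow N (e * a * b) * (torsion (e * a) b * torsion e a)
    both-sides = begin-equality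
      cardPow N (e * a * b) * torsion e (a * b)                ≡⟨ cong (λ t → cardPow N t * torsion e (a * b)) (*-assoc e a b) ⟩
      cardPow N (e * (a * b)) * torsion e (a * b)              ≡⟨ cardPow-torsion e (a * b) ⟨
      cardPow N e                                              ≡⟨ cardPow-torsion e a ⟩
      cardPow N (e * a) * torsion e a                          ≡⟨ cong (_* torsion e a) (cardPow-torsion (e * a) b) ⟩
      cardPow N (e * a * b) * torsion (e * a) b * torsion e a  ≡⟨ *-assoc (cardPow N (e * a * b)) _ _ ⟩
      cardPow N (e * a * b) * (torsion (e * a) b * torsion e a) ∎

  torsion≡1 : ∀ e f → (∀ o → 1 ≤ o → o ≤ N → Coprime o f) → torsion e f ≡ 1
  torsion≡1 e f orders⊥f = count≡1 (fibre e f 1) N 1 1<N (fibre-complete {e} {f} (IsPower-1 e) (1^% f)) trivial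
    where
    trivial : ∀ x → x < N → T (fibre e f 1 x) → x ≡ 1
    trivial x x<N t =
      let (x∈ , x^f≡1) = fibre-sound {e} {f} t
          (o , 1≤o , o≤N , x^o≡1) = order (IsPower-unit {e} x∈)
      in trans (sym (m<n⇒m%n≡m x<N)) (^%≡1-coprime x x^o≡1 x^f≡1 (orders⊥f o 1≤o o≤N))


module TorsionBound (N : ℕ) .{{_ : NonTrivial N}} (d : ℕ) .{{_ : NonZero d}} where

  open import Defs using (isUnit; condB; mp; Mstar; cardG; cardPow)
  open import Data.Nat
  open import Data.Nat.Properties
  open import Data.Nat.Divisibility using (_∣_)
  open import Data.Nat.Coprimality using (Coprime; prime⇒coprime)
  import Data.Nat.Coprimality as Coprimality
  open import Data.Nat.Primality using (Prime; prime?; prime⇒nonZero; prime⇒nonTrivial)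
  open import Data.Nat.ListAction.Properties using (∈⇒∣product)
  open import Data.List.Membership.Propositional.Properties using (∈-map⁺; ∈-filter⁺; ∈-upTo⁺)
  open import Data.Bool using (T)
  open import Data.Sum using ([_,_]′)
  open import Relation.Nullary using (Dec; yes; no)
  open import Relation.Binary.PropositionalEquality using (sym; trans; cong; cong₂; subst)
  open Arithmetic
  open Counting
  open PowerSubgroups N

  private
    m : ℕ → ℕ
    m = mp N d

  -- K(p^e) ≥ p^(d e / 10), cleared of denominators
  Condition : ℕ → ℕ → Set
  Condition p e = p ^ (d * e) * cardPow N (p ^ e) ^ 10 ≤ cardG N ^ 10

  condition-0 : ∀ p → Condition p 0
  condition-0 p = begin
    p ^ (d * 0) * cardPow N 1 ^ 10    ≡⟨ cong (λ e → p ^ e * cardPow N 1 ^ 10) (*-zeroʳ d) ⟩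
    1 * cardPow N 1 ^ 10              ≡⟨ *-identityˡ (cardPow N 1 ^ 10) ⟩
    cardPow N 1 ^ 10                  ≡⟨ cong (_^ 10) cardG≡cardPow-1 ⟨
    cardG N ^ 10                      ∎
    where open ≤-Reasoning

  condition-at-mp : ∀ p → Condition p (m p)
  condition-at-mp p = [ (λ m≡0 → subst (Condition p) (sym m≡0) (condition-0 p))
                       , ≤ᵇ⇒≤ (p ^ (d * m p) * cardPow N (p ^ m p) ^ 10) (cardG N ^ 10)
                       ]′ (lastSat-sat (condB N d p) (10 * N))

  condition-fails-beyond-range : ∀ p → Prime p → ∀ j → 10 * N < j → cardG N ^ 10 < p ^ (d * j) * cardPow N (p ^ j) ^ 10
  condition-fails-beyond-range p p-prime j 10N<j = begin-strict
    cardG N ^ 10             ≤⟨ ^-monoˡ-≤ 10 (count≤n (isUnit N) N) ⟩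
    N ^ 10                   ≤⟨ ^-monoˡ-≤ 10 (<⇒≤ (n<2^n N)) ⟩
    (2 ^ N) ^ 10             ≡⟨ ^-*-assoc 2 N 10 ⟩
    2 ^ (N * 10)             <⟨ ^-monoʳ-< 2 ≤-refl (subst (_< j) (*-comm 10 N) 10N<j) ⟩
    2 ^ j                    ≤⟨ ^-monoˡ-≤ j (nonTrivial⇒n>1 p {{prime⇒nonTrivial p-prime}}) ⟩
    p ^ j                    ≤⟨ ^-monoʳ-≤ p {{prime⇒nonZero p-prime}} (m≤n*m j d) ⟩
    p ^ (d * j)              ≤⟨ m≤m*n (p ^ (d * j)) (cardPow N (p ^ j) ^ 10) ⟩
    p ^ (d * j) * cardPow N (p ^ j) ^ 10 ∎
    where
    open ≤-Reasoning
    instance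
      |G^p^j|^10-nonZero : NonZero (cardPow N (p ^ j) ^ 10)
      |G^p^j|^10-nonZero = m^n≢0 (cardPow N (p ^ j)) 10 {{>-nonZero (cardPow>0 (p ^ j))}}

  -- m_p is only searched for up to 10 N; beyond that the condition fails anyway, since |G| ≤ N.
  condition-fails-after-mp : ∀ p → Prime p → cardG N ^ 10 < p ^ (d * suc (m p)) * cardPow N (p ^ suc (m p)) ^ 10
  condition-fails-after-mp p p-prime = by-range (suc (m p) ≤? 10 * N)
    where
    j : ℕ
    j = suc (m p)
    by-range : Dec (j ≤ 10 * N) → cardG N ^ 10 < p ^ (d * j) * cardPow N (p ^ j) ^ 10
    by-range (yes j≤10N) = ≰⇒> (λ holds → subst T (lastSat-max (condB N d p) (10 * N) j ≤-refl j≤10N)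
                                             (≤⇒≤ᵇ {p ^ (d * j) * cardPow N (p ^ j) ^ 10} {cardG N ^ 10} holds))
    by-range (no  j≰10N) = condition-fails-beyond-range p p-prime j (≰⇒> j≰10N)

  torsion-p^mp-bound : ∀ p → Prime p → torsion (p ^ m p) p ^ 10 < p ^ d
  torsion-p^mp-bound p p-prime =
    ^-ratio-bound {B = cardPow N (p ^ m p * p)} {T = torsion (p ^ m p) p} {P = p ^ (d * m p)} 10
      (cardPow-torsion (p ^ m p) p) (begin-strict
    p ^ (d * m p) * cardPow N (p ^ m p) ^ 10              ≤⟨ condition-at-mp p ⟩
    cardG N ^ 10                                          <⟨ condition-fails-after-mp p p-prime ⟩
    p ^ (d * suc (m p)) * cardPow N (p ^ suc (m p)) ^ 10
      ≡⟨ cong₂ (λ e q → p ^ e * cardPow N q ^ 10) (*-suc d (m p)) (*-comm p (p ^ m p)) ⟩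
    p ^ (d + d * m p) * cardPow N (p ^ m p * p) ^ 10
      ≡⟨ cong (_* cardPow N (p ^ m p * p) ^ 10) (trans (^-distribˡ-+-* p d (d * m p)) (*-comm (p ^ d) _)) ⟩
    p ^ (d * m p) * p ^ d * cardPow N (p ^ m p * p) ^ 10  ∎)
    where open ≤-Reasoning

  torsion-Mstar-prime : ∀ p → Prime p → torsion (Mstar N d) p ^ 10 ≤ p ^ d
  torsion-Mstar-prime p p-prime = by-size (p ≤? N)
    where
    by-size : Dec (p ≤ N) → torsion (Mstar N d) p ^ 10 ≤ p ^ d
    by-size (yes p≤N) = <⇒≤ (≤-<-trans (^-monoˡ-≤ 10 (torsion-∣ p p^m∣M)) (torsion-p^mp-bound p p-prime))
      where
      p^m∣M : p ^ m p ∣ Mstar N d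
      p^m∣M = ∈⇒∣product (∈-map⁺ (λ q → q ^ m q) (∈-filter⁺ prime? (∈-upTo⁺ (s≤s p≤N)) p-prime))
    by-size (no  p≰N) = begin
      torsion (Mstar N d) p ^ 10 ≡⟨ cong (_^ 10) (torsion≡1 (Mstar N d) p orders⊥p) ⟩
      1 ^ 10                     ≡⟨ ^-zeroˡ 10 ⟩
      1                          ≤⟨ m^n>0 p {{prime⇒nonZero p-prime}} d ⟩
      p ^ d                      ∎
      where
      open ≤-Reasoning
      orders⊥p : ∀ o → 1 ≤ o → o ≤ N → Coprime o p
      orders⊥p o 1≤o o≤N = Coprimality.sym (prime⇒coprime p-prime {{>-nonZero 1≤o}} (≤-<-trans o≤N (≰⇒> p≰N)))

  torsion-Mstar-bound : ∀ h → 1 ≤ h → torsion (Mstar N d) h ^ 10 ≤ h ^ d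
  torsion-Mstar-bound h 1≤h = submultiplicative-bound (torsion (Mstar N d)) 10 d
    (≤-reflexive (torsion≡1 (Mstar N d) 1 (λ o _ _ → Coprimality.sym coprime-1)))
    (torsion-* (Mstar N d)) torsion-Mstar-prime h {{>-nonZero 1≤h}}


module RationalsModℤ where

  open import Defs using (ModZ)
  open import Data.Nat as ℕ using (ℕ; zero; suc)
  import Data.Nat.Properties as ℕ
  open import Data.Nat.Divisibility using (∣1⇒≡1)
  open import Data.Integer as ℤ using (ℤ; +_; -[1+_])
  open import Data.Integer.DivMod using (_%ℕ_; _/ℕ_; a≡a%ℕn+[a/ℕn]*n)
  open import Data.Integer.Tactic.RingSolver using (solve-∀)
  open import Data.Rational using (ℚ; mkℚ; _+_; _*_; _-_; -_; 0ℚ; 1ℚ; _/_; ↥_; 1/_)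
  import Data.Rational.Properties as ℚ
  import Data.Rational.Unnormalised as ℚᵘ
  import Data.Rational.Unnormalised.Properties as ℚᵘ
  open import Data.Rational.Solver using (module +-*-Solver)
  open import Data.Product using (_,_)
  open import Relation.Nullary using (Dec; yes; no)
  open import Relation.Binary.Bundles using (Setoid)
  import Relation.Binary.Reasoning.Setoid
  open import Relation.Binary.PropositionalEquality using (_≡_; refl; sym; trans; cong; cong₂; subst; module ≡-Reasoning)
  open +-*-Solver

  IsInt : ℚ → Set
  IsInt q = ℚ.denominator-1 q ≡ 0

  fromℤ : ℤ → ℚ
  fromℤ z = mkℚ z 0 (λ (_ , d∣1) → ∣1⇒≡1 d∣1)

  ι : ℕ → ℚ
  ι k = (+ k) / 1

  ι≡fromℤ : ∀ k → ι k ≡ fromℤ (+ k)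
  ι≡fromℤ k = ℚ.↥p/↧p≡p (fromℤ (+ k))

  IsInt⇒≡fromℤ : ∀ q → IsInt q → q ≡ fromℤ (↥ q)
  IsInt⇒≡fromℤ (mkℚ _ .0 _) refl = refl

  fromℤ-+ : ∀ a b → fromℤ a + fromℤ b ≡ fromℤ (a ℤ.+ b)
  fromℤ-+ a b = ℚ.toℚᵘ-injective (ℚᵘ.≃-trans (ℚ.toℚᵘ-homo-+ (fromℤ a) (fromℤ b)) (ℚᵘ.*≡* (identity a b)))
    where
    identity : ∀ a b → (a ℤ.* + 1 ℤ.+ b ℤ.* + 1) ℤ.* + 1 ≡ (a ℤ.+ b) ℤ.* + 1
    identity = solve-∀

  fromℤ-* : ∀ a b → fromℤ a * fromℤ b ≡ fromℤ (a ℤ.* b)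
  fromℤ-* a b = ℚ.toℚᵘ-injective (ℚᵘ.≃-trans (ℚ.toℚᵘ-homo-* (fromℤ a) (fromℤ b)) (ℚᵘ.*≡* refl))

  fromℤ-neg : ∀ b → - fromℤ b ≡ fromℤ (ℤ.- b)
  fromℤ-neg (+ zero)  = refl
  fromℤ-neg (+ suc n) = refl
  fromℤ-neg -[1+ n ]  = refl

  ≡fromℤ⇒IsInt : ∀ {q} z → q ≡ fromℤ z → IsInt q
  ≡fromℤ⇒IsInt z refl = refl

  IsInt-+ : ∀ p q → IsInt p → IsInt q → IsInt (p + q)
  IsInt-+ p q p∈ℤ q∈ℤ = ≡fromℤ⇒IsInt (↥ p ℤ.+ ↥ q)
    (trans (cong₂ _+_ (IsInt⇒≡fromℤ p p∈ℤ) (IsInt⇒≡fromℤ q q∈ℤ)) (fromℤ-+ (↥ p) (↥ q)))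

  IsInt-* : ∀ p q → IsInt p → IsInt q → IsInt (p * q)
  IsInt-* p q p∈ℤ q∈ℤ = ≡fromℤ⇒IsInt (↥ p ℤ.* ↥ q)
    (trans (cong₂ _*_ (IsInt⇒≡fromℤ p p∈ℤ) (IsInt⇒≡fromℤ q q∈ℤ)) (fromℤ-* (↥ p) (↥ q)))

  IsInt-neg : ∀ p → IsInt p → IsInt (- p)
  IsInt-neg p p∈ℤ = ≡fromℤ⇒IsInt (ℤ.- ↥ p) (trans (cong -_ (IsInt⇒≡fromℤ p p∈ℤ)) (fromℤ-neg (↥ p)))

  IsInt-ι : ∀ k → IsInt (ι k)
  IsInt-ι k = ≡fromℤ⇒IsInt (+ k) (ι≡fromℤ k)

  -- a record, so that x and y can be inferred from its proofs
  infix 4 _≈_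
  record _≈_ (x y : ℚ) : Set where
    constructor mod-ℤ
    field integral : ModZ x y
  open _≈_ public

  _≈?_ : ∀ x y → Dec (x ≈ y)
  x ≈? y with ℚ.denominator-1 (x - y) ℕ.≟ 0
  ... | yes x-y∈ℤ = yes (mod-ℤ x-y∈ℤ)
  ... | no  x-y∉ℤ = no (λ x≈y → x-y∉ℤ (integral x≈y))

  ≈-reflexive : ∀ {x y} → x ≡ y → x ≈ y
  ≈-reflexive {x} refl = mod-ℤ (subst IsInt (sym (ℚ.+-inverseʳ x)) refl)

  ≈-refl : ∀ {x} → x ≈ x
  ≈-refl = ≈-reflexive refl

  ≈-sym : ∀ {x y} → x ≈ y → y ≈ x
  ≈-sym {x} {y} (mod-ℤ x-y∈ℤ) = mod-ℤ (subst IsInt (sym (rearrange x y)) (IsInt-neg (x - y) x-y∈ℤ))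
    where
    rearrange : ∀ x y → y - x ≡ - (x - y)
    rearrange = solve 2 (λ x y → y :- x := :- (x :- y)) refl

  ≈-trans : ∀ {x y z} → x ≈ y → y ≈ z → x ≈ z
  ≈-trans {x} {y} {z} (mod-ℤ x-y∈ℤ) (mod-ℤ y-z∈ℤ) =
    mod-ℤ (subst IsInt (sym (rearrange x y z)) (IsInt-+ (x - y) (y - z) x-y∈ℤ y-z∈ℤ))
    where
    rearrange : ∀ x y z → x - z ≡ (x - y) + (y - z)
    rearrange = solve 3 (λ x y z → x :- z := (x :- y) :+ (y :- z)) refl

  ≈-setoid : Setoid _ _
  ≈-setoid = record { Carrier = ℚ ; _≈_ = _≈_ ; isEquivalence = record { refl = ≈-refl ; sym = ≈-sym ; trans = ≈-trans } }

  module ≈-Reasoning = Relation.Binary.Reasoning.Setoid ≈-setoid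

  +-cong : ∀ {x x' y y'} → x ≈ x' → y ≈ y' → x + y ≈ x' + y'
  +-cong {x} {x'} {y} {y'} (mod-ℤ x∈ℤ) (mod-ℤ y∈ℤ) =
    mod-ℤ (subst IsInt (sym (rearrange x x' y y')) (IsInt-+ (x - x') (y - y') x∈ℤ y∈ℤ))
    where
    rearrange : ∀ x x' y y' → (x + y) - (x' + y') ≡ (x - x') + (y - y')
    rearrange = solve 4 (λ x x' y y' → (x :+ y) :- (x' :+ y') := (x :- x') :+ (y :- y')) refl

  ι*-cong : ∀ k {x y} → x ≈ y → ι k * x ≈ ι k * y
  ι*-cong k {x} {y} (mod-ℤ x-y∈ℤ) =
    mod-ℤ (subst IsInt (sym (rearrange (ι k) x y)) (IsInt-* (ι k) (x - y) (IsInt-ι k) x-y∈ℤ))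
    where
    rearrange : ∀ k x y → k * x - k * y ≡ k * (x - y)
    rearrange = solve 3 (λ k x y → k :* x :- k :* y := k :* (x :- y)) refl

  ≈-double⇒≈0 : ∀ {x} → x ≈ x + x → x ≈ 0ℚ
  ≈-double⇒≈0 {x} (mod-ℤ x-2x∈ℤ) = mod-ℤ (subst IsInt (sym (rearrange x)) (IsInt-neg (x - (x + x)) x-2x∈ℤ))
    where
    rearrange : ∀ x → x - 0ℚ ≡ - (x - (x + x))
    rearrange = solve 1 (λ x → x :- con 0ℚ := :- (x :- (x :+ x))) refl

  ι-zero : ∀ q → ι 0 * q ≡ 0ℚ
  ι-zero = solve 1 (λ q → con 0ℚ :* q := con 0ℚ) refl

  ι-suc : ∀ k q → ι (suc k) * q ≡ ι k * q + q
  ι-suc k q = trans (cong (_* q) ι[1+k]) (solve 2 (λ a q → (a :+ con 1ℚ) :* q := a :* q :+ q) refl (ι k) q)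
    where
    ι[1+k] : ι (suc k) ≡ ι k + 1ℚ
    ι[1+k] = begin
      ι (suc k)                  ≡⟨ ι≡fromℤ (suc k) ⟩
      fromℤ (+ suc k)            ≡⟨ cong (λ n → fromℤ (+ n)) (ℕ.+-comm 1 k) ⟩
      fromℤ (+ k ℤ.+ + 1)        ≡⟨ fromℤ-+ (+ k) (+ 1) ⟨
      fromℤ (+ k) + fromℤ (+ 1)  ≡⟨ cong (_+ 1ℚ) (ι≡fromℤ k) ⟨
      ι k + 1ℚ                   ∎
      where open ≡-Reasoning

  private
    fromℤ-cancelˡ : ∀ k .{{_ : ℕ.NonZero k}} {w v} → fromℤ (+ k) * w ≡ fromℤ (+ k) * v → w ≡ v
    fromℤ-cancelˡ k {w} {v} eq = begin
      w                    ≡⟨ ℚ.*-identityˡ w ⟨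
      1ℚ * w               ≡⟨ cong (_* w) (ℚ.*-inverseˡ K) ⟨
      1/ K * K * w         ≡⟨ ℚ.*-assoc (1/ K) K w ⟩
      1/ K * (K * w)       ≡⟨ cong (1/ K *_) eq ⟩
      1/ K * (K * v)       ≡⟨ ℚ.*-assoc (1/ K) K v ⟨
      1/ K * K * v         ≡⟨ cong (_* v) (ℚ.*-inverseˡ K) ⟩
      1ℚ * v               ≡⟨ ℚ.*-identityˡ v ⟩
      v                    ∎
      where
      open ≡-Reasoning
      K : ℚ
      K = fromℤ (+ k)

    ι-cancelˡ : ∀ k .{{_ : ℕ.NonZero k}} {w v} → ι k * w ≡ ι k * v → w ≡ v
    ι-cancelˡ k {w} {v} eq = fromℤ-cancelˡ k (subst (λ K → K * w ≡ K * v) (ι≡fromℤ k) eq)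

    %ℕ≡⇒-≡* : ∀ a b k .{{_ : ℕ.NonZero k}} → a %ℕ k ≡ b %ℕ k → a ℤ.- b ≡ (a /ℕ k ℤ.- b /ℕ k) ℤ.* + k
    %ℕ≡⇒-≡* a b k eq = begin
      a ℤ.- b
        ≡⟨ cong₂ ℤ._-_ (a≡a%ℕn+[a/ℕn]*n a k) (a≡a%ℕn+[a/ℕn]*n b k) ⟩
      (+ (a %ℕ k) ℤ.+ a /ℕ k ℤ.* + k) ℤ.- (+ (b %ℕ k) ℤ.+ b /ℕ k ℤ.* + k)
        ≡⟨ cong (λ r → (+ (a %ℕ k) ℤ.+ a /ℕ k ℤ.* + k) ℤ.- (+ r ℤ.+ b /ℕ k ℤ.* + k)) (sym eq) ⟩
      (+ (a %ℕ k) ℤ.+ a /ℕ k ℤ.* + k) ℤ.- (+ (a %ℕ k) ℤ.+ b /ℕ k ℤ.* + k)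
        ≡⟨ cancel (+ (a %ℕ k)) (a /ℕ k) (b /ℕ k) (+ k) ⟩
      (a /ℕ k ℤ.- b /ℕ k) ℤ.* + k ∎
      where
      open ≡-Reasoning
      cancel : ∀ r x y K → (r ℤ.+ x ℤ.* K) ℤ.- (r ℤ.+ y ℤ.* K) ≡ (x ℤ.- y) ℤ.* K
      cancel = solve-∀

  ≈-from-residues : ∀ k .{{_ : ℕ.NonZero k}} {x y} c → IsInt (ι k * x - c) → IsInt (ι k * y - c) →
    (↥ (ι k * x - c)) %ℕ k ≡ (↥ (ι k * y - c)) %ℕ k → x ≈ y
  ≈-from-residues k {x} {y} c u∈ℤ v∈ℤ same = mod-ℤ (≡fromℤ⇒IsInt q (ι-cancelˡ k k[x-y]≡kq))
    where
    open ≡-Reasoning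
    K : ℚ
    K = ι k
    u : ℚ
    u = K * x - c
    v : ℚ
    v = K * y - c
    q : ℤ
    q = ↥ u /ℕ k ℤ.- ↥ v /ℕ k
    k[x-y]≡kq : K * (x - y) ≡ K * fromℤ q
    k[x-y]≡kq = begin
      K * (x - y)                ≡⟨ solve 4 (λ K x y c → K :* (x :- y) := (K :* x :- c) :- (K :* y :- c)) refl K x y c ⟩
      u - v                      ≡⟨ cong₂ _-_ (IsInt⇒≡fromℤ u u∈ℤ) (IsInt⇒≡fromℤ v v∈ℤ) ⟩
      fromℤ (↥ u) - fromℤ (↥ v)  ≡⟨ cong (λ t → fromℤ (↥ u) + t) (fromℤ-neg (↥ v)) ⟩
      fromℤ (↥ u) + fromℤ (ℤ.- ↥ v) ≡⟨ fromℤ-+ (↥ u) (ℤ.- ↥ v) ⟩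
      fromℤ (↥ u ℤ.- ↥ v)        ≡⟨ cong fromℤ (%ℕ≡⇒-≡* (↥ u) (↥ v) k same) ⟩
      fromℤ (q ℤ.* + k)          ≡⟨ fromℤ-* q (+ k) ⟨
      fromℤ q * fromℤ (+ k)      ≡⟨ cong (fromℤ q *_) (ι≡fromℤ k) ⟨
      fromℤ q * K                ≡⟨ ℚ.*-comm (fromℤ q) K ⟩
      K * fromℤ q                ∎


module ListBounds where

  open import Data.Nat
  open import Data.Nat.Properties
  open import Data.List using (List; []; _∷_; length; filter; map)
  open import Data.List.Properties using (length-filter; length-map)
  open import Data.List.Relation.Unary.All as All using (All; []; _∷_)
  import Data.List.Relation.Unary.All.Properties as All
  open import Data.List.Relation.Unary.AllPairs using (AllPairs; []; _∷_)
  import Data.List.Relation.Unary.AllPairs.Properties as AllPairs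
  open import Data.List.Relation.Unary.Any using (here; there)
  open import Data.List.Relation.Binary.Subset.Propositional using (_⊆_)
  import Data.List.Relation.Binary.Subset.Propositional.Properties as Subset
  open import Data.Product using (Σ-syntax; _×_; _,_)
  open import Relation.Nullary using (¬_; Dec; yes; no; contradiction)
  open import Relation.Nullary.Decidable using (¬?)
  open import Function using (_∘_)
  open import Relation.Binary.PropositionalEquality using (_≡_; _≢_; refl; sym; trans; cong; subst)

  length-filter-¬ : ∀ {X : Set} {P : X → Set} (P? : ∀ x → Dec (P x)) xs →
    length (filter P? xs) + length (filter (¬? ∘ P?) xs) ≡ length xs
  length-filter-¬ P? [] = refl
  length-filter-¬ P? (x ∷ xs) with P? x
  ... | yes _ = cong suc (length-filter-¬ P? xs)
  ... | no  _ = trans (+-suc _ _) (cong suc (length-filter-¬ P? xs))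

  distinct-bounded-length : ∀ K (xs : List ℕ) → AllPairs _≢_ xs → All (_< K) xs → length xs ≤ K
  distinct-bounded-length zero    []       _        _          = z≤n
  distinct-bounded-length zero    (x ∷ xs) _        (() ∷ _)
  distinct-bounded-length (suc K) xs       distinct bounded = begin
    length xs                           ≡⟨ length-filter-¬ (_≟ K) xs ⟨
    length atK + length others
      ≤⟨ +-mono-≤ (at-most-one atK (All.all-filter (_≟ K) xs) (AllPairs.filter⁺ (_≟ K) distinct))
                  (distinct-bounded-length K others (AllPairs.filter⁺ (¬? ∘ (_≟ K)) distinct) others<K) ⟩
    1 + K                               ∎
    where
    open ≤-Reasoning
    atK others : List ℕ
    atK    = filter (_≟ K) xs
    others = filter (¬? ∘ (_≟ K)) xs
    at-most-one : ∀ ys → All (_≡ K) ys → AllPairs _≢_ ys → length ys ≤ 1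
    at-most-one []           _                _                 = z≤n
    at-most-one (_ ∷ [])     _                _                 = s≤s z≤n
    at-most-one (_ ∷ _ ∷ _)  (y≡K ∷ z≡K ∷ _) ((y≢z ∷ _) ∷ _)   = contradiction (trans y≡K (sym z≡K)) y≢z
    others<K : All (_< K) others
    others<K = All.zipWith (λ (x<1+K , x≢K) → ≤∧≢⇒< (≤-pred x<1+K) x≢K)
      (All.filter⁺ (¬? ∘ (_≟ K)) bounded , All.all-filter (¬? ∘ (_≟ K)) xs)

  distinct-keys-length : ∀ {X : Set} (key : X → ℕ) K (L : List X) →
    AllPairs (λ a b → key a ≢ key b) L → All (λ a → key a < K) L → length L ≤ K
  distinct-keys-length key K L distinct bounded = subst (_≤ K) (length-map key L)
    (distinct-bounded-length K (map key L) (AllPairs.map⁺ distinct) (All.map⁺ bounded))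

  module _ {X : Set} (Q : X → Set) (R S : X → X → Set) (R? : ∀ x y → Dec (R x y)) (R-refl : ∀ x → R x x) where

    private
      Separated : (X → X → Set) → List X → Set
      Separated T = AllPairs (λ a b → ¬ T a b)

    -- Choose one representative per R-class: the representatives are R-separated, and each class
    -- has at most k members.
    class-bound : ∀ P k →
      (∀ L → All Q L → Separated R L → length L ≤ P) →
      (∀ ψ L → Q ψ → All Q L → All (R ψ) L → Separated S L → length L ≤ k) →
      ∀ L → All Q L → Separated S L → length L ≤ k * P
    class-bound P k R-bound class-size L QL sep with representatives (length L) L ≤-refl QL sep
      where
      representatives : ∀ n L → length L ≤ n → All Q L → Separated S L →
        Σ[ rs ∈ List X ] rs ⊆ L × Separated R rs × length L ≤ k * length rs
      representatives _       []       _          _          _ = [] , (λ ()) , [] , z≤n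
      representatives (suc n) (ψ ∷ L) (s≤s |L|≤n) (Qψ ∷ QL) (ψ-sep ∷ sep)
        with representatives n (filter (¬? ∘ R? ψ) L) (≤-trans (length-filter (¬? ∘ R? ψ) L) |L|≤n)
               (All.filter⁺ (¬? ∘ R? ψ) QL) (AllPairs.filter⁺ (¬? ∘ R? ψ) sep)
      ... | rs , rs⊆ , rs-sep , |rest|≤krs = ψ ∷ rs , ⊆-cons , (ψ-apart ∷ rs-sep) , |ψ∷L|≤k[1+rs]
        where
        ⊆-cons : ψ ∷ rs ⊆ ψ ∷ L
        ⊆-cons (here eq) = here eq
        ⊆-cons (there x∈rs) = there (Subset.filter-⊆ (¬? ∘ R? ψ) L (rs⊆ x∈rs))
        ψ-apart : All (λ b → ¬ R ψ b) rs
        ψ-apart = All.anti-mono rs⊆ (All.all-filter (¬? ∘ R? ψ) L)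
        class : length (ψ ∷ filter (R? ψ) L) ≤ k
        class = class-size ψ (ψ ∷ filter (R? ψ) L) Qψ (Qψ ∷ All.filter⁺ (R? ψ) QL) (R-refl ψ ∷ All.all-filter (R? ψ) L)
                  (All.filter⁺ (R? ψ) ψ-sep ∷ AllPairs.filter⁺ (R? ψ) sep)
        |ψ∷L|≤k[1+rs] : suc (length L) ≤ k * suc (length rs)
        |ψ∷L|≤k[1+rs] = begin
          suc (length L)                                                ≡⟨ cong suc (length-filter-¬ (R? ψ) L) ⟨
          suc (length (filter (R? ψ) L) + length (filter (¬? ∘ R? ψ) L)) ≤⟨ +-mono-≤ class |rest|≤krs ⟩
          k + k * length rs                                             ≡⟨ *-suc k (length rs) ⟨
          k * suc (length rs)                                           ∎
          where open ≤-Reasoning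
    ... | rs , rs⊆ , rs-sep , |L|≤krs = ≤-trans |L|≤krs (*-monoʳ-≤ k (R-bound rs (All.anti-mono rs⊆ QL) rs-sep))


module Characters (N : ℕ) .{{_ : NonTrivial N}} (M : ℕ) where

  open import Defs using (IsCharacter)
  open import Data.Nat using (zero; suc; _<_; _*_)
  open import Data.Bool using (Bool; T)
  open import Data.Fin using (Fin; toℕ; fromℕ<)
  open import Data.Fin.Properties using (all?; toℕ-fromℕ<)
  open import Data.Rational using (ℚ; 0ℚ) renaming (_+_ to _+ℚ_; _*_ to _*ℚ_)
  open import Relation.Nullary using (Dec; yes; no)
  open import Relation.Nullary.Decidable using (T?; _→-dec_)
  open import Relation.Binary.PropositionalEquality using (sym; trans; cong; subst)
  open import Function using (_∘_)
  open Residues N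
  open PowerSubgroups N
  open RationalsModℤ

  -- a record, so that φ can be inferred from its proofs
  record Character (φ : ℕ → ℚ) : Set where
    constructor character
    field is-character : IsCharacter N M φ

  Agree : (ℕ → Bool) → (ℕ → ℚ) → (ℕ → ℚ) → Set
  Agree C φ φ' = ∀ b → T (C b) → φ b ≈ φ' b

  module _ {φ : ℕ → ℚ} (φ-char : Character φ) where
    open Character φ-char

    char-*% : ∀ {b c} → IsPower M b → IsPower M c → φ (b *% c) ≈ φ b +ℚ φ c
    char-*% {b} {c} b∈ c∈ = subst (λ x → φ x ≈ φ b +ℚ φ c) (modN≡% (b * c))
      (mod-ℤ (is-character b c (isPow-complete b∈) (isPow-complete c∈)))

    char-1 : φ 1 ≈ 0ℚ
    char-1 = ≈-double⇒≈0 (subst (λ x → φ x ≈ φ 1 +ℚ φ 1) (trans (*%-identityˡ 1) 1%N)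
                                 (char-*% (IsPower-1 M) (IsPower-1 M)))

    char-^% : ∀ {g} → IsPower M g → ∀ i → φ (g ^% i) ≈ ι i *ℚ φ g
    char-^% {g} g∈ zero = begin
      φ (g ^% 0)     ≡⟨ cong φ (^%-zero g) ⟩
      φ 1            ≈⟨ char-1 ⟩
      0ℚ             ≡⟨ ι-zero (φ g) ⟨
      ι 0 *ℚ φ g     ∎
      where open ≈-Reasoning
    char-^% {g} g∈ (suc i) = begin
      φ (g ^% suc i)      ≡⟨ cong φ (^%-suc g (IsPower-<N g∈) i) ⟩
      φ (g ^% i *% g)     ≈⟨ char-*% (IsPower-^% i g∈) g∈ ⟩
      φ (g ^% i) +ℚ φ g   ≈⟨ +-cong (char-^% g∈ i) (≈-refl {φ g}) ⟩
      ι i *ℚ φ g +ℚ φ g   ≡⟨ ι-suc i (φ g) ⟨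
      ι (suc i) *ℚ φ g    ∎
      where open ≈-Reasoning

  Agree? : ∀ C → (∀ {x} → T (C x) → x < N) → ∀ φ φ' → Dec (Agree C φ φ')
  Agree? C C<N φ φ' with all? (λ (i : Fin N) → T? (C (toℕ i)) →-dec (φ (toℕ i) ≈? φ' (toℕ i)))
  ... | yes agree = yes (λ b Cb → subst (λ x → φ x ≈ φ' x) (toℕ-fromℕ< (C<N Cb))
                                    (agree (fromℕ< (C<N Cb)) (subst (T ∘ C) (sym (toℕ-fromℕ< (C<N Cb))) Cb)))
  ... | no ¬agree = no (λ agree → ¬agree (λ i Ci → agree (toℕ i) Ci))


module CharacterBound (N : ℕ) .{{_ : NonTrivial N}} (M h : ℕ) (1≤h : 1 ≤ h) (ψ₀ : ℕ → ℚ) where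

  open import Defs using (CharEq; pow; isPow; count; cardPow)
  open import Data.Nat hiding (_≤_)
  open import Data.Nat.Properties
  open import Data.Nat.DivMod using (_%_; _/_; m≡m%n+[m/n]*n; m<n*o⇒m/o<n; m%n<n; m<n⇒m%n≡m)
  open import Data.Integer.DivMod using (_%ℕ_; n%ℕd<d)
  open import Data.Nat.Coprimality using (Coprime)
  open import Data.Nat.Divisibility using (m∣m*n)
  open import Data.Bool using (Bool; T; _∧_)
  open import Data.Bool.Properties using (T-∧)
  open import Data.Bool.ListAction using (any)
  open import Data.List using (List; []; _∷_; length; upTo)
  open import Data.List.Relation.Unary.All as All using (All; []; _∷_)
  open import Data.List.Relation.Unary.AllPairs as AllPairs using (AllPairs; []; _∷_)
  open import Data.List.Membership.Propositional using (find; lose)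
  open import Data.List.Membership.Propositional.Properties using (∈-upTo⁺; ∈-upTo⁻)
  open import Data.List.Relation.Unary.Any.Properties using (any⁺; any⁻)
  open import Data.Product using (Σ-syntax; _×_; _,_; proj₁; proj₂)
  open import Data.Sum using (inj₁; inj₂)
  open import Relation.Binary.Definitions using (tri<; tri≈; tri>)
  open import Function using (_∘_; Equivalence)
  open import Relation.Nullary using (¬_; contradiction; Dec; yes; no)
  open import Relation.Nullary.Decidable using (T?)
  open import Relation.Binary.PropositionalEquality using (_≡_; _≢_; refl; sym; trans; cong; cong₂; subst; module ≡-Reasoning)
  open import Data.Rational using (↥_) renaming (_+_ to _+ℚ_; _*_ to _*ℚ_; _-_ to _-ℚ_)
  open Arithmetic
  open Counting
  open ListBounds
  open Residues N
  open PowerSubgroups N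
  open RationalsModℤ
  open Characters N M

  Eligible : (ℕ → ℚ) → Set
  Eligible φ = Character φ × CharEq N M (pow h φ) (pow h ψ₀)

  Separated : (ℕ → Bool) → List (ℕ → ℚ) → Set
  Separated C = AllPairs (λ φ φ' → ¬ Agree C φ φ')

  eligible-agree : ∀ {φ φ'} → Eligible φ → Eligible φ' → Agree (isPow N (M * h)) φ φ'
  eligible-agree {φ} {φ'} (φ-char , φ^h) (φ'-char , φ'^h) b b∈ =
    let (c , c∈ , c^h≡b) = IsPower-root {M} h (isPow-sound (M * h) b∈) in subst (λ x → φ x ≈ φ' x) c^h≡b (at-h-th-power c∈)
    where
    at-h-th-power : ∀ {c} → IsPower M c → φ (c ^% h) ≈ φ' (c ^% h)
    at-h-th-power {c} c∈ = begin
      φ (c ^% h)     ≈⟨ char-^% φ-char c∈ h ⟩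
      ι h *ℚ φ c     ≈⟨ mod-ℤ (φ^h c (isPow-complete c∈)) ⟩
      ι h *ℚ ψ₀ c    ≈⟨ ≈-sym (mod-ℤ (φ'^h c (isPow-complete c∈))) ⟩
      ι h *ℚ φ' c    ≈⟨ ≈-sym (char-^% φ'-char c∈ h) ⟩
      φ' (c ^% h)    ∎
      where open ≈-Reasoning

  record Stage (j : ℕ) : Set where
    field
      C          : ℕ → Bool
      C<N        : ∀ {x} → T (C x) → x < N
      C⊆G^M      : ∀ {x} → T (C x) → IsPower M x
      G^Mh⊆C     : ∀ {x} → IsPower (M * h) x → T (C x)
      C-*%       : ∀ {x y} → T (C x) → T (C y) → T (C (x *% y))
      covers     : ∀ {x} → x < j → IsPower M x → T (C x)
      index      : ℕ
      index-size : index * cardPow N (M * h) ≤ count C N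
      separated  : ∀ L → All Eligible L → Separated C L → length L ≤ index

    C-1 : T (C 1)
    C-1 = G^Mh⊆C (IsPower-1 (M * h))

    C-^% : ∀ {y} → T (C y) → ∀ e → T (C (y ^% e))
    C-^% {y} Cy zero    = subst (T ∘ C) (sym (^%-zero y)) C-1
    C-^% {y} Cy (suc e) = subst (T ∘ C) (sym (^%-suc y (C<N Cy) e)) (C-*% (C-^% Cy e) Cy)

    C-cancelˡ : ∀ {y z} → T (C y) → T (C (y *% z)) → z < N → T (C z)
    C-cancelˡ {y} {z} Cy Cyz z<N with order (IsPower-unit (C⊆G^M Cy))
    ... | o , 1≤o , _ , y^o≡1 = subst (T ∘ C) y⁻¹yz≡z (C-*% (C-^% Cy (o ∸ 1)) Cyz)
      where
      y⁻¹yz≡z : y ^% (o ∸ 1) *% (y *% z) ≡ z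
      y⁻¹yz≡z = begin
        y ^% (o ∸ 1) *% (y *% z)     ≡⟨ *%-assoc (y ^% (o ∸ 1)) y z ⟨
        y ^% (o ∸ 1) *% y *% z       ≡⟨ cong (_*% z) (^%-pred-inverse y (C<N Cy) 1≤o y^o≡1) ⟩
        1 *% z                       ≡⟨ *%-identityˡ z ⟩
        z % N                        ≡⟨ m<n⇒m%n≡m z<N ⟩
        z                            ∎
        where open ≡-Reasoning

  base : Stage 0
  base = record
    { C          = isPow N (M * h)
    ; C<N        = IsPower-<N ∘ isPow-sound (M * h)
    ; C⊆G^M      = IsPower-∣ (m∣m*n h) ∘ isPow-sound (M * h)
    ; G^Mh⊆C     = isPow-complete
    ; C-*%       = λ x∈ y∈ → isPow-complete (IsPower-*% (isPow-sound (M * h) x∈) (isPow-sound (M * h) y∈))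
    ; covers     = λ ()
    ; index      = 1
    ; index-size = ≤-reflexive (+-identityʳ _)
    ; separated  = at-most-one
    }
    where
    at-most-one : ∀ L → All Eligible L → Separated (isPow N (M * h)) L → length L ≤ 1
    at-most-one []             _                 _               = z≤n
    at-most-one (_ ∷ [])       _                 _               = s≤s z≤n
    at-most-one (_ ∷ _ ∷ _)    (φ-el ∷ φ'-el ∷ _) ((¬agree ∷ _) ∷ _) = contradiction (eligible-agree φ-el φ'-el) ¬agree

  module Extension {j} (S : Stage j) (j∈G^M : IsPower M j) where
    open Stage S

    private
      g : ℕ
      g = j
      g<N : g < N
      g<N = IsPower-<N j∈G^M
      g^1≡g : g ^% 1 ≡ g
      g^1≡g = trans (^%-one g) (m<n⇒m%n≡m g<N)
      minimal : Σ[ k ∈ ℕ ] LeastPositive (λ i → C (g ^% i)) k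
      minimal = least-positive (λ i → C (g ^% i)) 1≤h (G^Mh⊆C (^%-IsPower h j∈G^M))

    k : ℕ
    k = proj₁ minimal

    1≤k : 1 ≤ k
    1≤k = proj₁ (proj₂ minimal)

    Cg^k : T (C (g ^% k))
    Cg^k = proj₁ (proj₂ (proj₂ minimal))

    below-k : ∀ i → 1 ≤ i → i < k → ¬ T (C (g ^% i))
    below-k = proj₂ (proj₂ (proj₂ minimal))

    instance
      k-nonZero : NonZero k
      k-nonZero = >-nonZero 1≤k

    -- C' = C ∪ C g ∪ … ∪ C g^(k-1), the subgroup generated by C and g
    C' : ℕ → Bool
    C' x = any (λ i → any (λ y → C y ∧ (y *% g ^% i ≡ᵇ x)) (upTo N)) (upTo k)

    record Coset (x : ℕ) : Set where
      constructor coset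
      field
        {i y}   : ℕ
        i<k     : i < k
        Cy      : T (C y)
        y*g^i≡x : y *% g ^% i ≡ x

    C'-sound : ∀ {x} → T (C' x) → Coset x
    C'-sound {x} t with find (any⁻ _ (upTo k) t)
    ... | i , i∈ , ti with find (any⁻ _ (upTo N) ti)
    ...   | y , _ , ty = let (Cy , eq) = Equivalence.to T-∧ ty in coset (∈-upTo⁻ i∈) Cy (≡ᵇ⇒≡ _ x eq)

    C'-complete : ∀ {i y} → i < k → T (C y) → T (C' (y *% g ^% i))
    C'-complete {i} {y} i<k Cy = any⁺ _ (lose (∈-upTo⁺ i<k) (any⁺ _ (lose (∈-upTo⁺ (C<N Cy))
      (Equivalence.from T-∧ (Cy , ≡⇒≡ᵇ (y *% g ^% i) _ refl)))))

    C⊆C' : ∀ {x} → T (C x) → T (C' x)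
    C⊆C' {x} Cx = subst (T ∘ C') (trans (cong (x *%_) (^%-zero g)) (trans (*%-identityʳ x) (m<n⇒m%n≡m (C<N Cx))))
                    (C'-complete 1≤k Cx)

    g∈C' : T (C' g)
    g∈C' with m≤n⇒m<n∨m≡n 1≤k
    ... | inj₁ 1<k = subst (T ∘ C') (trans (*%-identityˡ (g ^% 1)) (trans (^%-% g 1) g^1≡g)) (C'-complete 1<k C-1)
    ... | inj₂ 1≡k = C⊆C' (subst (T ∘ C) g^1≡g (subst (λ i → T (C (g ^% i))) (sym 1≡k) Cg^k))

    C'<N : ∀ {x} → T (C' x) → x < N
    C'<N t with C'-sound t
    ... | coset {i} {y} _ _ refl = *%<N y (g ^% i)

    C'⊆G^M : ∀ {x} → T (C' x) → IsPower M x
    C'⊆G^M t with C'-sound t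
    ... | coset {i} _ Cy refl = IsPower-*% (C⊆G^M Cy) (IsPower-^% i j∈G^M)

    C'-*% : ∀ {x x'} → T (C' x) → T (C' x') → T (C' (x *% x'))
    C'-*% t t' with C'-sound t | C'-sound t'
    ... | coset {i} {y} i<k Cy refl | coset {i'} {y'} i'<k Cy' refl =
      subst (T ∘ C') (sym product) (reduce (i + i' <? k))
      where
      Cyy' : T (C (y *% y'))
      Cyy' = C-*% Cy Cy'
      product : y *% g ^% i *% (y' *% g ^% i') ≡ y *% y' *% g ^% (i + i')
      product = trans (*%-interchange y (g ^% i) y' (g ^% i')) (cong (y *% y' *%_) (sym (^%-+ g i i')))
      reduce : Dec (i + i' < k) → T (C' (y *% y' *% g ^% (i + i')))
      reduce (yes i+i'<k) = C'-complete i+i'<k Cyy'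
      reduce (no  i+i'≮k) = subst (T ∘ C') shift (C'-complete r<k (C-*% Cyy' Cg^k))
        where
        r : ℕ
        r = i + i' ∸ k
        k+r≡i+i' : k + r ≡ i + i'
        k+r≡i+i' = m+[n∸m]≡n (≮⇒≥ i+i'≮k)
        r<k : r < k
        r<k = +-cancelˡ-< k r k (subst (_< k + k) (sym k+r≡i+i') (+-mono-< i<k i'<k))
        shift : y *% y' *% g ^% k *% g ^% r ≡ y *% y' *% g ^% (i + i')
        shift = trans (*%-assoc (y *% y') (g ^% k) (g ^% r)) (cong (y *% y' *%_) (trans (sym (^%-+ g k r)) (cong (g ^%_) k+r≡i+i')))

    covers' : ∀ {x} → x < suc j → IsPower M x → T (C' x)
    covers' x<1+j x∈ with m<1+n⇒m<n∨m≡n x<1+j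
    ... | inj₁ x<j  = C⊆C' (covers x<j x∈)
    ... | inj₂ refl = g∈C'

    private
      g^-unit : ∀ i → Coprime (g ^% i) N
      g^-unit i = coprime-^% i (IsPower-unit j∈G^M)

    cosets-disjoint : ∀ {y y' i i'} → T (C y) → T (C y') → i < i' → i' < k → y *% g ^% i ≢ y' *% g ^% i'
    cosets-disjoint {y} {y'} {i} {i'} Cy Cy' i<i' i'<k eq =
      below-k (i' ∸ i) (m<n⇒0<n∸m i<i') (≤-<-trans (m∸n≤m i' i) i'<k)
        (C-cancelˡ Cy' (subst (T ∘ C) y≡y'g^d Cy) (^%<N g (i' ∸ i)))
      where
      open ≡-Reasoning
      d : ℕ
      d = i' ∸ i
      y≡y'g^d : y ≡ y' *% g ^% d
      y≡y'g^d = *%-cancelˡ y (y' *% g ^% d) (g^-unit i) (C<N Cy) (*%<N y' (g ^% d)) (begin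
        g ^% i *% y               ≡⟨ *%-comm (g ^% i) y ⟩
        y *% g ^% i               ≡⟨ eq ⟩
        y' *% g ^% i'             ≡⟨ cong (λ e → y' *% g ^% e) (m+[n∸m]≡n (<⇒≤ i<i')) ⟨
        y' *% g ^% (i + d)        ≡⟨ cong (y' *%_) (^%-+ g i d) ⟩
        y' *% (g ^% i *% g ^% d)  ≡⟨ *%-assoc y' (g ^% i) (g ^% d) ⟨
        y' *% g ^% i *% g ^% d    ≡⟨ cong (_*% g ^% d) (*%-comm y' (g ^% i)) ⟩
        g ^% i *% y' *% g ^% d    ≡⟨ *%-assoc (g ^% i) y' (g ^% d) ⟩
        g ^% i *% (y' *% g ^% d)  ∎)

    C'-size : k * count C N ≤ count C' N
    C'-size = begin
      k * count C N                       ≡⟨ count-mod C N k ⟨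
      count (λ m → C (m % N)) (k * N)     ≤⟨ count-injection (k * N) N into-coset
                                               (λ m m<kN Cm → *%<N (m % N) _ , C'-complete (m<n*o⇒m/o<n m<kN) Cm) injective ⟩
      count C' N                          ∎
      where
      open ≤-Reasoning
      into-coset : ℕ → ℕ
      into-coset m = m % N *% g ^% (m / N)
      injective : ∀ m m' → m < k * N → m' < k * N → T (C (m % N)) → T (C (m' % N)) →
                  into-coset m ≡ into-coset m' → m ≡ m'
      injective m m' m<kN m'<kN Cm Cm' eq with <-cmp (m / N) (m' / N)
      ... | tri< lt _ _ = contradiction eq (cosets-disjoint Cm Cm' lt (m<n*o⇒m/o<n m'<kN))
      ... | tri> _ _ gt = contradiction (sym eq) (cosets-disjoint Cm' Cm gt (m<n*o⇒m/o<n m<kN))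
      ... | tri≈ _ same _ = begin-equality
        m                               ≡⟨ m≡m%n+[m/n]*n m N ⟩
        m % N + m / N * N               ≡⟨ cong₂ (λ r q → r + q * N) same-residue same ⟩
        m' % N + m' / N * N             ≡⟨ m≡m%n+[m/n]*n m' N ⟨
        m'                              ∎
        where
        same-residue : m % N ≡ m' % N
        same-residue = *%-cancelˡ (m % N) (m' % N) (g^-unit (m / N)) (m%n<n m N) (m%n<n m' N)
          (trans (*%-comm (g ^% (m / N)) (m % N)) (trans eq (trans (cong (λ e → m' % N *% g ^% e) (sym same)) (*%-comm (m' % N) _))))

    agree-on-C' : ∀ {φ φ'} → Character φ → Character φ' → Agree C φ φ' → φ g ≈ φ' g → Agree C' φ φ'
    agree-on-C' {φ} {φ'} φ-char φ'-char agree φg≈φ'g x t with C'-sound t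
    ... | coset {i} {y} _ Cy refl = begin
      φ (y *% g ^% i)           ≈⟨ char-*% φ-char (C⊆G^M Cy) g^i∈ ⟩
      φ y +ℚ φ (g ^% i)         ≈⟨ +-cong (agree y Cy) (char-^% φ-char j∈G^M i) ⟩
      φ' y +ℚ ι i *ℚ φ g        ≈⟨ +-cong (≈-refl {φ' y}) (ι*-cong i φg≈φ'g) ⟩
      φ' y +ℚ ι i *ℚ φ' g       ≈⟨ +-cong (≈-refl {φ' y}) (≈-sym (char-^% φ'-char j∈G^M i)) ⟩
      φ' y +ℚ φ' (g ^% i)       ≈⟨ ≈-sym (char-*% φ'-char (C⊆G^M Cy) g^i∈) ⟩
      φ' (y *% g ^% i)          ∎
      where
      open ≈-Reasoning
      g^i∈ : IsPower M (g ^% i)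
      g^i∈ = IsPower-^% i j∈G^M

    -- Within the C-class of ψ, k φ(g) ≡ φ(g^k) = ψ(g^k) ≡ k ψ(g) modulo ℤ, so φ(g) modulo ℤ is
    -- determined by the residue modulo k of the integer k φ(g) - k ψ(g).
    class-size : ∀ ψ L → Eligible ψ → All Eligible L → All (Agree C ψ) L → Separated C' L → length L ≤ k
    class-size ψ L (ψ-char , _) L-eligible L-agree L-sep =
      distinct-keys-length key k L (keys-distinct L L-eligible L-agree L-sep) (All.universal (λ φ → n%ℕd<d (↥ (shift φ)) k) L)
      where
      shift : (ℕ → ℚ) → ℚ
      shift φ = ι k *ℚ φ g -ℚ ι k *ℚ ψ g
      key : (ℕ → ℚ) → ℕ
      key φ = ↥ (shift φ) %ℕ k
      shift-integral : ∀ {φ} → Eligible φ → Agree C ψ φ → IsInt (shift φ)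
      shift-integral {φ} (φ-char , _) ψ≈φ = integral (begin
        ι k *ℚ φ g      ≈⟨ ≈-sym (char-^% φ-char j∈G^M k) ⟩
        φ (g ^% k)      ≈⟨ ≈-sym (ψ≈φ _ Cg^k) ⟩
        ψ (g ^% k)      ≈⟨ char-^% ψ-char j∈G^M k ⟩
        ι k *ℚ ψ g      ∎)
        where open ≈-Reasoning
      same-key : ∀ {φ φ'} → Eligible φ → Eligible φ' → Agree C ψ φ → Agree C ψ φ' →
                 key φ ≡ key φ' → Agree C' φ φ'
      same-key φ-el φ'-el ψ≈φ ψ≈φ' eq = agree-on-C' (proj₁ φ-el) (proj₁ φ'-el)
        (λ b Cb → ≈-trans (≈-sym (ψ≈φ b Cb)) (ψ≈φ' b Cb))
        (≈-from-residues k (ι k *ℚ ψ g) (shift-integral φ-el ψ≈φ) (shift-integral φ'-el ψ≈φ') eq)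
      keys-distinct : ∀ L → All Eligible L → All (Agree C ψ) L → Separated C' L →
                      AllPairs (λ φ φ' → key φ ≢ key φ') L
      keys-distinct []       _                 _               _               = []
      keys-distinct (φ ∷ L) (φ-el ∷ L-el) (ψ≈φ ∷ L-agree) (φ-sep ∷ L-sep) =
        All.zipWith (λ (¬agree , φ'-el , ψ≈φ') → ¬agree ∘ same-key φ-el φ'-el ψ≈φ ψ≈φ')
          (φ-sep , All.zipWith (λ p → p) (L-el , L-agree))
        ∷ keys-distinct L L-el L-agree L-sep

    extended : Stage (suc j)
    extended = record
      { C          = C'
      ; C<N        = C'<N
      ; C⊆G^M      = C'⊆G^M
      ; G^Mh⊆C     = C⊆C' ∘ G^Mh⊆C
      ; C-*%       = C'-*%
      ; covers     = covers'
      ; index      = k * index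
      ; index-size = ≤-trans (≤-reflexive (*-assoc k index _)) (≤-trans (*-monoʳ-≤ k index-size) C'-size)
      ; separated  = class-bound Eligible (Agree C) (Agree C') (Agree? C C<N) (λ _ _ _ → ≈-refl) index k separated class-size
      }

  skip : ∀ {j} → Stage j → ¬ IsPower M j → Stage (suc j)
  skip {j} S j∉G^M = record
    { C = C ; C<N = C<N ; C⊆G^M = C⊆G^M ; G^Mh⊆C = G^Mh⊆C ; C-*% = C-*%
    ; covers = covers' ; index = index ; index-size = index-size ; separated = separated }
    where
    open Stage S
    covers' : ∀ {x} → x < suc j → IsPower M x → T (C x)
    covers' x<1+j x∈ with m<1+n⇒m<n∨m≡n x<1+j
    ... | inj₁ x<j  = covers x<j x∈
    ... | inj₂ refl = contradiction x∈ j∉G^M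

  stage : ∀ j → Stage j
  stage zero    = base
  stage (suc j) with T? (isPow N M j)
  ... | yes j∈ = Extension.extended (stage j) (isPow-sound M j∈)
  ... | no  j∉ = skip (stage j) (j∉ ∘ isPow-complete)

  separated-bound : ∀ L → All Eligible L → AllPairs (λ φ φ' → ¬ CharEq N M φ φ') L → length L ≤ torsion M h
  separated-bound L L-el L-sep = ≤-trans (separated L L-el (AllPairs.map ¬CharEq⇒¬Agree L-sep)) index≤torsion
    where
    open Stage (stage N)
    ¬CharEq⇒¬Agree : ∀ {φ φ'} → ¬ CharEq N M φ φ' → ¬ Agree C φ φ'
    ¬CharEq⇒¬Agree ¬eq agree = ¬eq (λ b b∈ →
      let b∈G^M = isPow-sound M b∈ in integral (agree b (covers (IsPower-<N b∈G^M) b∈G^M)))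
    index≤torsion : index ≤ torsion M h
    index≤torsion = *-cancelʳ-≤ index (torsion M h) (cardPow N (M * h)) {{>-nonZero (cardPow>0 (M * h))}} (begin
      index * cardPow N (M * h)          ≤⟨ index-size ⟩
      count C N                          ≤⟨ count-mono N (λ x _ → isPow-complete ∘ C⊆G^M) ⟩
      cardPow N M                        ≡⟨ cardPow-torsion M h ⟩
      cardPow N (M * h) * torsion M h    ≡⟨ *-comm (cardPow N (M * h)) _ ⟩
      torsion M h * cardPow N (M * h)    ∎)
      where open ≤-Reasoning


open import Data.Nat using (zero; suc; z≤n; s≤s; _*_; _!; >-nonZero; n>1⇒nonTrivial)
open import Data.Nat.Properties using (≤-trans; <-trans; +-identityʳ; m≤n*m; ^-monoˡ-≤; <⇒≱)
open import Data.Fin using (zero)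
open import Data.List using (tabulate)
open import Data.List.Properties using (length-tabulate)
import Data.List.Relation.Unary.All.Properties as All
import Data.List.Relation.Unary.AllPairs.Properties as AllPairs
open import Data.Product using (_,_)
open import Relation.Nullary using (contradiction)
open import Relation.Binary.PropositionalEquality using (_≡_; refl; cong; trans; subst)
open Characters using (character)

a0≡! : ∀ m → a 0 m ≡ m !
a0≡! zero    = refl
a0≡! (suc m) = trans (+-identityʳ _) (cong (suc m *_) (a0≡! m))

ceil-sqrt-log-pos : ∀ {N d} → 1 ≤ N → IsCeilSqrtLog N d → NonZero d
ceil-sqrt-log-pos {N} {zero} 1≤N ((m , N*m!<a0m) , _) =
  contradiction (m≤n*m (m !) N {{>-nonZero 1≤N}}) (<⇒≱ (subst (N * m ! <_) (a0≡! m) N*m!<a0m))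
ceil-sqrt-log-pos {d = suc d} _ _ = _

lemma3p5 : (N : ℕ) → 2 < N → (d : ℕ) → IsCeilSqrtLog N d →
    (h : ℕ) → 1 ≤ h → (n : ℕ) → (χ : Fin n → ℕ → ℚ) →
    (∀ i → IsCharacter N (Mstar N d) (χ i)) →
    (∀ i j → i ≢ j → ¬ CharEq N (Mstar N d) (χ i) (χ j)) →
    (∀ i j → CharEq N (Mstar N d) (pow h (χ i)) (pow h (χ j))) →
    n ^ 10 ≤ h ^ d
lemma3p5 N 2<N d d≡⌈√logN⌉ h 1≤h zero    χ _ _ _ = z≤n
lemma3p5 N 2<N d d≡⌈√logN⌉ h 1≤h (suc n) χ χ-char χ-distinct χ^h-equal =
  ≤-trans (^-monoˡ-≤ 10 n≤torsion) (torsion-Mstar-bound h 1≤h)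
  where
  instance
    N-nonTrivial : NonTrivial N
    N-nonTrivial = n>1⇒nonTrivial (<-trans (s≤s (s≤s z≤n)) 2<N)
    d-nonZero : NonZero d
    d-nonZero = ceil-sqrt-log-pos (<-trans (s≤s z≤n) 2<N) d≡⌈√logN⌉
  open TorsionBound N d using (torsion-Mstar-bound)
  open CharacterBound N (Mstar N d) h 1≤h (χ zero) using (separated-bound)
  open PowerSubgroups N using (torsion)
  n≤torsion : suc n ≤ torsion (Mstar N d) h
  n≤torsion = subst (_≤ torsion (Mstar N d) h) (length-tabulate χ)
    (separated-bound (tabulate χ) (All.tabulate⁺ (λ i → character (χ-char i) , χ^h-equal i zero))
                     (AllPairs.tabulate⁺ {f = χ} (λ {i} {j} → χ-distinct i j)))
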